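{- Let $F$ be a graph of diameter $2$ with $n=|V(F)|$ and minimum degree $t=\delta(F)$, and let $l>n$ be an integer. Let $A_{2l-1}$ be the graph with vertex set $\{1,\dots,2l-1\}$ in which distinct $i,j$ are adjacent iff $|i-j|\le l-1$, and let $F_{2l}$ be obtained from $A_{2l-1}$ by adding a vertex $2l$ and the edges $(1,2l),\dots,(t,2l)$. Let $z_i$ and $f_i$ be the $F$-degrees of vertex $i$ in $A_{2l-1}$ and in $F_{2l}$, respectively, and $\delta_l=f_l-z_l$. If $C_{l-2}^{n-2}>n!\,C_{l-2}^{n-t-2}$, then $0<\delta_l<z_{i+1}-z_i$ for all $i\in\{t+1,t+2,\dots,l-1\}$.
   Context: All graphs are finite, simple and undirected. For graphs $F$ and $G$ and a vertex $v$ of $G$, the $F$-degree of $v$ in $G$ is the number of subgraphs of $G$ (not necessarily induced) that are isomorphic to $F$ and contain $v$. $\delta(F)$ is the minimum vertex degree of $F$. $C_m^k=\frac{m!}{k!(m-k)!}$ for integers $m\ge k\ge0$ and $C_m^k=0$ otherwise. -}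

module Defs where

open import Data.Bool using (Bool; true; false; _∧_; _∨_; not; if_then_else_)
open import Data.Bool.Properties using (∨-comm)
open import Data.Bool.Properties using () renaming (_≟_ to _≟ᵇ_)
open import Data.Nat using (ℕ; zero; suc; _+_; _∸_; _≤_; _<_; _≤ᵇ_; _<ᵇ_; _*_)
open import Data.Nat.Combinatorics using (_C_)
open import Data.Fin using (Fin; toℕ; _≟_)
open import Data.Fin.Properties using (any?; all?)
open import Data.Vec using (Vec; []; _∷_; lookup)
open import Data.List using (List; []; _∷_; length; filter; concatMap; map; allFin)
open import Data.Product using (Σ; ∃; _×_; _,_; proj₁; proj₂)
open import Relation.Binary.PropositionalEquality using (_≡_; _≢_; refl)
open import Relation.Nullary using (Dec; yes; no; ¬_)
open import Relation.Nullary.Decidable using (map′; _×-dec_; _→-dec_; ¬?)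

record Graph : Set where
  field
    size   : ℕ
    adj    : Fin size → Fin size → Bool
    sym    : ∀ i j → adj i j ≡ adj j i
    irrefl : ∀ i → adj i i ≡ false
open Graph public

degree : (G : Graph) → Fin (size G) → ℕ
degree G v = length (filter (λ w → adj G v w ≟ᵇ true) (allFin (size G)))

IsMinDegree : Graph → ℕ → Set
IsMinDegree G t = (∃ λ v → degree G v ≡ t) × (∀ v → t ≤ degree G v)

HasDiameter2 : Graph → Set
HasDiameter2 G =
  (∀ u v → u ≢ v → adj G u v ≡ false →
     ∃ λ w → (adj G u w ≡ true) × (adj G w v ≡ true))
  × (∃ λ u → ∃ λ v → (u ≢ v) × (adj G u v ≡ false))

allVecs : {A : Set} → List A → (k : ℕ) → List (Vec A k)
allVecs xs zero    = [] ∷ []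
allVecs xs (suc k) = concatMap (λ x → map (x ∷_) (allVecs xs k)) xs

bools : List Bool
bools = true ∷ false ∷ []

anyVec? : ∀ {m} n {P : Vec (Fin m) n → Set} → (∀ v → Dec (P v)) → Dec (∃ P)
anyVec? zero    P? = map′ (λ p → [] , p) (λ { ([] , p) → p }) (P? [])
anyVec? (suc n) P? =
  map′ (λ { (x , v , p) → (x ∷ v) , p })
       (λ { ((x ∷ v) , p) → x , v , p })
       (any? (λ x → anyVec? n (λ v → P? (x ∷ v))))

-- Subgraphs of G: a vertex set S (characteristic vector) and an edge set
-- E (symmetric 0/1 matrix), with E ⊆ E(G) and each edge of E having both
-- endpoints in S.

module _ (F G : Graph) where
  private
    n = size F
    m = size G

  VSet = Vec Bool m
  ESet = Vec (Vec Bool m) m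

  _∈E_ : Fin m × Fin m → ESet → Bool
  (i , j) ∈E E = lookup (lookup E i) j

  IsSubgraph : VSet → ESet → Set
  IsSubgraph S E =
      (∀ i j → (i , j) ∈E E ≡ true → adj G i j ≡ true)
    × (∀ i j → (i , j) ∈E E ≡ (j , i) ∈E E)
    × (∀ i j → (i , j) ∈E E ≡ true → lookup S i ≡ true)

  IsIso : VSet → ESet → Vec (Fin m) n → Set
  IsIso S E φ =
      (∀ i j → lookup φ i ≡ lookup φ j → i ≡ j)
    × (∀ i → lookup S (lookup φ i) ≡ true)
    × (∀ w → lookup S w ≡ true → ∃ λ i → lookup φ i ≡ w)
    × (∀ i j → adj F i j ≡ (lookup φ i , lookup φ j) ∈E E)

  IsFCopyAt : Fin m → VSet × ESet → Set
  IsFCopyAt v (S , E) =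
    IsSubgraph S E × (∃ λ φ → IsIso S E φ) × (lookup S v ≡ true)

  isSubgraph? : ∀ S E → Dec (IsSubgraph S E)
  isSubgraph? S E =
        all? (λ i → all? (λ j → ((i , j) ∈E E ≟ᵇ true) →-dec (adj G i j ≟ᵇ true)))
    ×-dec all? (λ i → all? (λ j → (i , j) ∈E E ≟ᵇ (j , i) ∈E E))
    ×-dec all? (λ i → all? (λ j → ((i , j) ∈E E ≟ᵇ true) →-dec (lookup S i ≟ᵇ true)))

  isIso? : ∀ S E φ → Dec (IsIso S E φ)
  isIso? S E φ =
        all? (λ i → all? (λ j → (lookup φ i ≟ lookup φ j) →-dec (i ≟ j)))
    ×-dec all? (λ i → lookup S (lookup φ i) ≟ᵇ true)
    ×-dec all? (λ w → (lookup S w ≟ᵇ true) →-dec any? (λ i → lookup φ i ≟ w))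
    ×-dec all? (λ i → all? (λ j → adj F i j ≟ᵇ (lookup φ i , lookup φ j) ∈E E))

  isFCopyAt? : ∀ v p → Dec (IsFCopyAt v p)
  isFCopyAt? v (S , E) =
    isSubgraph? S E ×-dec anyVec? n (isIso? S E) ×-dec (lookup S v ≟ᵇ true)

  allPairs : List (VSet × ESet)
  allPairs = concatMap (λ S → map (S ,_) (allVecs (allVecs bools m) m))
                       (allVecs bools m)

  FDegree : Fin m → ℕ
  FDegree v = length (filter (isFCopyAt? v) allPairs)

-- Binomial coefficient C_m^{a-b} with the convention C_m^k = 0 for k < 0
-- (i.e. when a < b); for k > m, stdlib's _C_ already gives 0.

Cdiff : ℕ → ℕ → ℕ → ℕ
Cdiff m a b = if a <ᵇ b then 0 else m C (a ∸ b)

-- The graphs A_{2l-1} and F_{2l}.  Paper vertex k (1 ≤ k ≤ 2l-1 resp. 2l)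
-- is represented by the index k-1 : Fin _.

absDiff : ℕ → ℕ → ℕ
absDiff a b = (a ∸ b) + (b ∸ a)

eqᵇ-sym : ∀ a b → (a Data.Nat.≡ᵇ b) ≡ (b Data.Nat.≡ᵇ a)
eqᵇ-sym zero    zero    = refl
eqᵇ-sym zero    (suc b) = refl
eqᵇ-sym (suc a) zero    = refl
eqᵇ-sym (suc a) (suc b) = eqᵇ-sym a b

eqᵇ-refl : ∀ a → (a Data.Nat.≡ᵇ a) ≡ true
eqᵇ-refl zero    = refl
eqᵇ-refl (suc a) = eqᵇ-refl a

symGraph : (k : ℕ) → (ℕ → ℕ → Bool) → Graph
symGraph k r = record
  { size   = k
  ; adj    = λ i j → ad (toℕ i) (toℕ j)
  ; sym    = λ i j → sy (toℕ i) (toℕ j)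
  ; irrefl = λ i → ir (toℕ i)
  }
  where
  ad : ℕ → ℕ → Bool
  ad a b = not (a Data.Nat.≡ᵇ b) ∧ (r a b ∨ r b a)
  sy : ∀ a b → ad a b ≡ ad b a
  sy a b rewrite eqᵇ-sym a b | ∨-comm (r a b) (r b a) = refl
  ir : ∀ a → ad a a ≡ false
  ir a rewrite eqᵇ-refl a = refl

A : (l : ℕ) → Graph
A l = symGraph (2 * l ∸ 1) (λ a b → absDiff a b ≤ᵇ (l ∸ 1))

-- F_{2l}: A_{2l-1} plus vertex 2l (index 2l-1) joined to vertices 1..t
-- (indices 0..t-1)
Fgraph : (l t : ℕ) → Graph
Fgraph l t = symGraph (2 * l)
  (λ a b → ((a <ᵇ N) ∧ (b <ᵇ N) ∧ (absDiff a b ≤ᵇ (l ∸ 1)))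
         ∨ ((a Data.Nat.≡ᵇ N) ∧ (b <ᵇ t)))
  where N = 2 * l ∸ 1

{-# OPTIONS --safe #-}
-- A copy of F through l in F_{2l} either avoids the new vertex 2l, and restriction to A_{2l-1} is a
-- bijection from these onto the copies through l there, or it contains 2l; so f_l - z_l is the number D
-- of copies through both l and 2l. Mapping a vertex of minimum degree to 2l gives such a copy, so D ≥ 1.
-- Every copy through l and 2l contains the neighbours 1, ..., t of 2l (they receive the at least t
-- neighbours of the preimage of 2l) and, F having diameter two, lies within distance two of 2l; it is
-- thus determined by n - t - 2 further vertices among l - 2 candidates and by a bijection from V(F), so
-- D ≤ n! C(l-2, n-t-2). Finally, for i ≤ l - 1 the transposition of i and i + 1 maps the copies through
-- i avoiding i + 1 injectively to copies through i + 1 avoiding i, none of which contains the edge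
-- (i + 1, i + l); the cliques on {i + 1, i + l} ∪ X, with X any (n - 2)-subset of {i + 2, ..., i + l - 1},
-- contain it. Hence z_{i+1} - z_i ≥ C(l-2, n-2) > n! C(l-2, n-t-2) ≥ D.
module Submission where

open import Defs hiding (sym)
open import Data.Bool using (Bool; true; false; T; not; _∧_; _∨_; if_then_else_)
open import Data.Bool.Properties using (T-≡; T-∧; T-∨; ∨-identityʳ) renaming (_≟_ to _≟ᵇ_)
open import Data.Unit using (tt)
open import Data.Empty using (⊥-elim)
open import Data.Nat
open import Data.Nat.Properties
open import Data.Nat.Combinatorics using (_C_; nCk+nC[k+1]≡[n+1]C[k+1])
open import Data.Fin as Fin using (Fin; toℕ; fromℕ; fromℕ<; inject₁; lower₁)
import Data.Fin.Properties as Fin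
open import Data.Fin.Properties using (any?)
open import Data.Fin.Permutation.Components using (transpose; transpose-inverse)
open import Data.Vec as Vec using (Vec; []; _∷_; lookup; tabulate)
import Data.Vec.Properties as Vec
open import Data.List as List
  using (List; []; _∷_; _++_; length; map; filter; concatMap; cartesianProductWith; cartesianProduct; allFin)
import Data.List.Properties as List
open import Data.List.Membership.Propositional using (_∈_; _∉_)
open import Data.List.Membership.Propositional.Properties
open import Data.List.Relation.Unary.Any using (here; there; index)
import Data.List.Relation.Unary.Any.Properties as Any
open import Data.List.Relation.Unary.All.Properties using (¬Any⇒All¬; All¬⇒¬Any)
open import Data.List.Relation.Unary.Unique.Propositional using (Unique; []; _∷_)
import Data.List.Relation.Unary.Unique.Propositional.Properties as Unique
open import Data.List.Relation.Binary.Subset.Propositional using (_⊆_)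
open import Data.Product using (∃; ∃₂; _×_; _,_; proj₁; proj₂)
open import Data.Sum using (_⊎_; inj₁; inj₂; [_,_]′)
open import Function using (_∘_; id; Equivalence)
open import Function.Definitions using (Injective)
open import Relation.Binary.PropositionalEquality
open import Relation.Binary.Definitions using (DecidableEquality)
open import Relation.Nullary using (Dec; yes; no; does; ¬_)
open import Relation.Nullary.Decidable using (_×-dec_; ¬?; dec-true; dec-false)
open import Relation.Unary using (Decidable)
open import Relation.Unary.Properties using (_∩?_; ∁?)


private
  variable
    X Y Z : Set

Unique-∷ : ∀ {x : X} {xs} → x ∉ xs → Unique xs → Unique (x ∷ xs)
Unique-∷ x∉ u = ¬Any⇒All¬ _ x∉ ∷ u

∈-∷-≢ : ∀ {x y : X} {ys} → x ≢ y → x ∈ y ∷ ys → x ∈ ys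
∈-∷-≢ x≢y (here x≡y) = ⊥-elim (x≢y x≡y)
∈-∷-≢ x≢y (there x∈) = x∈

length-≤-of-⊆ : {xs ys : List X} → Unique xs → xs ⊆ ys → length xs ≤ length ys
length-≤-of-⊆ [] _ = z≤n
length-≤-of-⊆ {xs = x ∷ xs} (x∉ ∷ u) xs⊆ys with ∈-∃++ (xs⊆ys (here refl))
... | as , bs , refl = begin
    suc (length xs)           ≤⟨ s≤s (length-≤-of-⊆ u xs⊆as++bs) ⟩
    suc (length (as ++ bs))   ≡⟨ List.length-++-sucʳ as x bs ⟨
    length (as ++ x ∷ bs)     ∎
  where
  open ≤-Reasoning
  xs⊆as++bs : xs ⊆ as ++ bs
  xs⊆as++bs {y} y∈xs with ∈-++⁻ as (xs⊆ys (there y∈xs))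
  ... | inj₁ y∈as = ∈-++⁺ˡ y∈as
  ... | inj₂ (here refl) = ⊥-elim (All¬⇒¬Any x∉ y∈xs)
  ... | inj₂ (there y∈bs) = ∈-++⁺ʳ as y∈bs

Unique-map-on : (g : X → Y) {xs : List X} → Unique xs →
  (∀ {a b} → a ∈ xs → b ∈ xs → g a ≡ g b → a ≡ b) → Unique (map g xs)
Unique-map-on g [] inj = []
Unique-map-on g {x ∷ xs} (x∉ ∷ u) inj =
  Unique-∷ gx∉ (Unique-map-on g u (λ a∈ b∈ → inj (there a∈) (there b∈)))
  where
  gx∉ : g x ∉ map g xs
  gx∉ gx∈ with ∈-map⁻ g gx∈
  ... | y , y∈ , gx≡gy = All¬⇒¬Any x∉ (subst (_∈ xs) (sym (inj (here refl) (there y∈) gx≡gy)) y∈)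

length-≤-by-injection : (g : X → Y) {xs : List X} {ys : List Y} → Unique xs →
  (∀ {a b} → a ∈ xs → b ∈ xs → g a ≡ g b → a ≡ b) → (∀ {a} → a ∈ xs → g a ∈ ys) →
  length xs ≤ length ys
length-≤-by-injection g {xs} u inj into = subst (_≤ _) (List.length-map g xs)
  (length-≤-of-⊆ (Unique-map-on g u inj) λ b∈ → case (∈-map⁻ g b∈))
  where
  case : ∀ {b} → ∃ (λ a → a ∈ xs × b ≡ g a) → b ∈ _
  case (a , a∈ , refl) = into a∈

length-≤-by-surjection : (g : X → Y) {xs : List X} {ys : List Y} → Unique ys →
  (∀ {b} → b ∈ ys → ∃ λ a → a ∈ xs × g a ≡ b) → length ys ≤ length xs
length-≤-by-surjection g {xs} u onto = subst (_ ≤_) (List.length-map g xs)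
  (length-≤-of-⊆ u λ b∈ → case (onto b∈))
  where
  case : ∀ {b} → ∃ (λ a → a ∈ xs × g a ≡ b) → b ∈ map g xs
  case (a , a∈ , refl) = ∈-map⁺ g a∈

length-filter-split : {P Q : X → Set} (P? : Decidable P) (Q? : Decidable Q) (xs : List X) →
  length (filter P? xs) ≡ length (filter (P? ∩? Q?) xs) + length (filter (P? ∩? ∁? Q?) xs)
length-filter-split P? Q? [] = refl
length-filter-split P? Q? (x ∷ xs) with P? x | Q? x
... | yes _ | yes _ = cong suc (length-filter-split P? Q? xs)
... | yes _ | no _  = trans (cong suc (length-filter-split P? Q? xs)) (sym (+-suc _ _))
... | no _  | _     = length-filter-split P? Q? xs

concatMap-map≡cartesianProductWith : (f : X → Y → Z) (xs : List X) (ys : List Y) →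
  concatMap (λ x → map (f x) ys) xs ≡ cartesianProductWith f xs ys
concatMap-map≡cartesianProductWith f []       ys = refl
concatMap-map≡cartesianProductWith f (x ∷ xs) ys =
  cong (map (f x) ys ++_) (concatMap-map≡cartesianProductWith f xs ys)

length-cartesianProductWith : (f : X → Y → Z) (xs : List X) (ys : List Y) →
  length (cartesianProductWith f xs ys) ≡ length xs * length ys
length-cartesianProductWith f []       ys = refl
length-cartesianProductWith f (x ∷ xs) ys = begin
  length (map (f x) ys ++ cartesianProductWith f xs ys)
    ≡⟨ List.length-++ (map (f x) ys) ⟩
  length (map (f x) ys) + length (cartesianProductWith f xs ys)
    ≡⟨ cong₂ _+_ (List.length-map (f x) ys) (length-cartesianProductWith f xs ys) ⟩
  length ys + length xs * length ys ∎
  where open ≡-Reasoning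

subsets : ℕ → List X → List (List X)
subsets zero    xs       = [] ∷ []
subsets (suc k) []       = []
subsets (suc k) (x ∷ xs) = map (x ∷_) (subsets k xs) ++ subsets (suc k) xs

length-subsets : ∀ k (xs : List X) → length (subsets k xs) ≡ length xs C k
length-subsets zero    xs       = refl
length-subsets (suc k) []       = refl
length-subsets (suc k) (x ∷ xs) = begin
  length (map (x ∷_) (subsets k xs) ++ subsets (suc k) xs)
    ≡⟨ List.length-++ (map (x ∷_) (subsets k xs)) ⟩
  length (map (x ∷_) (subsets k xs)) + length (subsets (suc k) xs)
    ≡⟨ cong₂ _+_ (trans (List.length-map _ (subsets k xs)) (length-subsets k xs))
                 (length-subsets (suc k) xs) ⟩
  length xs C k + length xs C suc k
    ≡⟨ nCk+nC[k+1]≡[n+1]C[k+1] (length xs) k ⟩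
  suc (length xs) C suc k ∎
  where open ≡-Reasoning

∈-subsets-∷⁻ : ∀ k {x : X} {xs ss} → ss ∈ subsets (suc k) (x ∷ xs) →
  (∃ λ ss′ → ss ≡ x ∷ ss′ × ss′ ∈ subsets k xs) ⊎ ss ∈ subsets (suc k) xs
∈-subsets-∷⁻ k {x} {xs} ss∈ with ∈-++⁻ (map (x ∷_) (subsets k xs)) ss∈
... | inj₂ ss∈′ = inj₂ ss∈′
... | inj₁ ss∈′ with ∈-map⁻ (x ∷_) ss∈′
...   | ss′ , ss′∈ , refl = inj₁ (ss′ , refl , ss′∈)

∈-subsets⇒length : ∀ k (xs : List X) {ss} → ss ∈ subsets k xs → length ss ≡ k
∈-subsets⇒length zero    xs       (here refl) = refl
∈-subsets⇒length (suc k) (x ∷ xs) ss∈ with ∈-subsets-∷⁻ k ss∈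
... | inj₁ (ss′ , refl , ss′∈) = cong suc (∈-subsets⇒length k xs ss′∈)
... | inj₂ ss∈′               = ∈-subsets⇒length (suc k) xs ss∈′

∈-subsets⇒⊆ : ∀ k (xs : List X) {ss} → ss ∈ subsets k xs → ss ⊆ xs
∈-subsets⇒⊆ zero    xs       (here refl) ()
∈-subsets⇒⊆ (suc k) (x ∷ xs) ss∈ with ∈-subsets-∷⁻ k ss∈
... | inj₁ (ss′ , refl , ss′∈) = λ { (here refl) → here refl
                                    ; (there w∈) → there (∈-subsets⇒⊆ k xs ss′∈ w∈) }
... | inj₂ ss∈′               = there ∘ ∈-subsets⇒⊆ (suc k) xs ss∈′

∈-subsets⇒Unique : ∀ k {xs : List X} {ss} → Unique xs → ss ∈ subsets k xs → Unique ss
∈-subsets⇒Unique zero    _ (here refl) = []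
∈-subsets⇒Unique (suc k) {x ∷ xs} (x∉ ∷ u) ss∈ with ∈-subsets-∷⁻ k ss∈
... | inj₁ (ss′ , refl , ss′∈) =
  Unique-∷ (All¬⇒¬Any x∉ ∘ ∈-subsets⇒⊆ k xs ss′∈) (∈-subsets⇒Unique k u ss′∈)
... | inj₂ ss∈′ = ∈-subsets⇒Unique (suc k) u ss∈′

subsets-unique : ∀ k {xs : List X} → Unique xs → Unique (subsets k xs)
subsets-unique zero    _ = Unique-∷ (λ ()) []
subsets-unique (suc k) {[]} _ = []
subsets-unique (suc k) {x ∷ xs} (x∉ ∷ u) =
  Unique.++⁺ (Unique.map⁺ (λ { refl → refl }) (subsets-unique k u)) (subsets-unique (suc k) u) disjoint
  where
  disjoint : ∀ {ss} → ¬ (ss ∈ map (x ∷_) (subsets k xs) × ss ∈ subsets (suc k) xs)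
  disjoint (ss∈ , ss∈′) with ∈-map⁻ (x ∷_) ss∈
  ... | _ , _ , refl = All¬⇒¬Any x∉ (∈-subsets⇒⊆ (suc k) xs ss∈′ (here refl))

⊆-∷⁻ : ∀ {x : X} {rs ts} → x ∉ rs → rs ⊆ x ∷ ts → rs ⊆ ts
⊆-∷⁻ x∉rs rs⊆ w∈ with rs⊆ w∈
... | here refl = ⊥-elim (x∉rs w∈)
... | there w∈′ = w∈′

subsets-⊆⇒≡ : ∀ k {xs : List X} {ss ts} → Unique xs → ss ∈ subsets k xs → ts ∈ subsets k xs →
  ss ⊆ ts → ss ≡ ts
subsets-⊆⇒≡ zero    _ (here refl) (here refl) _ = refl
subsets-⊆⇒≡ (suc k) {x ∷ xs} (x∉ ∷ u) ss∈ ts∈ ss⊆ts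
  with ∈-subsets-∷⁻ k ss∈ | ∈-subsets-∷⁻ k ts∈
... | inj₁ (ss′ , refl , ss′∈) | inj₁ (ts′ , refl , ts′∈) =
  cong (x ∷_) (subsets-⊆⇒≡ k u ss′∈ ts′∈
    (⊆-∷⁻ (All¬⇒¬Any x∉ ∘ ∈-subsets⇒⊆ k xs ss′∈) (ss⊆ts ∘ there)))
... | inj₁ (ss′ , refl , ss′∈) | inj₂ ts∈′ =
  ⊥-elim (All¬⇒¬Any x∉ (∈-subsets⇒⊆ (suc k) xs ts∈′ (ss⊆ts (here refl))))
subsets-⊆⇒≡ (suc k) {x ∷ xs} {ss} (x∉ ∷ u) ss∈ ts∈ ss⊆ts
    | inj₂ ss∈′ | inj₁ (ts′ , refl , ts′∈) = ⊥-elim (1+n≰n (begin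
    suc k       ≡⟨ ∈-subsets⇒length (suc k) xs ss∈′ ⟨
    length ss    ≤⟨ length-≤-of-⊆ (∈-subsets⇒Unique (suc k) u ss∈′)
                     (⊆-∷⁻ (All¬⇒¬Any x∉ ∘ ∈-subsets⇒⊆ (suc k) xs ss∈′) ss⊆ts) ⟩
    length ts′   ≡⟨ ∈-subsets⇒length k xs ts′∈ ⟩
    k           ∎))
  where open ≤-Reasoning
subsets-⊆⇒≡ (suc k) {x ∷ xs} (x∉ ∷ u) ss∈ ts∈ ss⊆ts
    | inj₂ ss∈′ | inj₂ ts∈′ = subsets-⊆⇒≡ (suc k) u ss∈′ ts∈′ ss⊆ts

filter∈subsets : {P : X → Set} (P? : Decidable P) (xs : List X) →
  filter P? xs ∈ subsets (length (filter P? xs)) xs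
filter∈subsets P? [] = here refl
filter∈subsets P? (x ∷ xs) with does (P? x)
... | true = ∈-++⁺ˡ (∈-map⁺ (x ∷_) (filter∈subsets P? xs))
... | false with filter P? xs in eq
...   | []     = here refl
...   | y ∷ ys = ∈-++⁺ʳ (map (x ∷_) (subsets (length ys) xs))
                   (subst (λ ss → ss ∈ subsets (length ss) xs) eq (filter∈subsets P? xs))

length-allFin : ∀ n → length (allFin n) ≡ n
length-allFin n = List.length-tabulate id

length-of-complete : ∀ {n} {xs : List (Fin n)} → Unique xs → (∀ k → k ∈ xs) → length xs ≡ n
length-of-complete {n} {xs} u complete = ≤-antisym
  (subst (length xs ≤_) (length-allFin n) (length-≤-of-⊆ u (λ {k} _ → ∈-allFin k)))
  (subst (_≤ length xs) (length-allFin n) (length-≤-of-⊆ (Unique.allFin⁺ n) (λ {k} _ → complete k)))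

Bool-ext : ∀ {b c : Bool} → (b ≡ true → c ≡ true) → (c ≡ true → b ≡ true) → b ≡ c
Bool-ext {false} {false} _ _ = refl
Bool-ext {false} {true}  _ c⇒b = c⇒b refl
Bool-ext {true}  {false} b⇒c _ = sym (b⇒c refl)
Bool-ext {true}  {true}  _ _ = refl

does-true⇒ : ∀ {X : Set} (a? : Dec X) → does a? ≡ true → X
does-true⇒ (yes a) _ = a

vec-ext : ∀ {X : Set} {k} {xs ys : Vec X k} → (∀ i → lookup xs i ≡ lookup ys i) → xs ≡ ys
vec-ext {xs = xs} {ys} eq =
  trans (sym (Vec.tabulate∘lookup xs)) (trans (Vec.tabulate-cong eq) (Vec.tabulate∘lookup ys))

injections : ∀ k j → List (Vec (Fin k) j)
injections k       zero    = [] ∷ []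
injections zero    (suc j) = []
injections (suc k) (suc j) =
  cartesianProductWith (λ h v → h ∷ Vec.map (Fin.punchIn h) v) (allFin (suc k)) (injections k j)

length-injections : ∀ n → length (injections n n) ≡ n !
length-injections zero    = refl
length-injections (suc n) = begin
  length (injections (suc n) (suc n))
    ≡⟨ length-cartesianProductWith _ (allFin (suc n)) (injections n n) ⟩
  length (allFin (suc n)) * length (injections n n)
    ≡⟨ cong₂ _*_ (length-allFin (suc n)) (length-injections n) ⟩
  suc n * n ! ∎
  where open ≡-Reasoning

∈-injections : ∀ {k j} (v : Vec (Fin k) j) → Injective _≡_ _≡_ (lookup v) → v ∈ injections k j
∈-injections {j = zero}      []      _   = here refl
∈-injections {zero} {suc j}  (() ∷ _) _
∈-injections {suc k} {suc j} (h ∷ v) inj =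
  subst (_∈ injections (suc k) (suc j)) (cong (h ∷_) punchIn∘punchOut)
  (∈-cartesianProductWith⁺ (λ h v → h ∷ Vec.map (Fin.punchIn h) v) (∈-allFin h)
    (∈-injections v′ v′-injective))
  where
  h≢ : ∀ i → h ≢ lookup v i
  h≢ i h≡ with inj {Fin.zero} {Fin.suc i} h≡
  ... | ()
  v′ : Vec (Fin k) j
  v′ = tabulate λ i → Fin.punchOut (h≢ i)
  v′-injective : Injective _≡_ _≡_ (lookup v′)
  v′-injective {i} {i′} eq = Fin.suc-injective (inj (Fin.punchOut-injective (h≢ i) (h≢ i′)
    (trans (sym (Vec.lookup∘tabulate _ i)) (trans eq (Vec.lookup∘tabulate _ i′)))))
  punchIn∘punchOut : Vec.map (Fin.punchIn h) v′ ≡ v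
  punchIn∘punchOut = vec-ext λ i → begin
    lookup (Vec.map (Fin.punchIn h) v′) i   ≡⟨ Vec.lookup-map i (Fin.punchIn h) v′ ⟩
    Fin.punchIn h (lookup v′ i)             ≡⟨ cong (Fin.punchIn h) (Vec.lookup∘tabulate _ i) ⟩
    Fin.punchIn h (Fin.punchOut (h≢ i))     ≡⟨ Fin.punchIn-punchOut (h≢ i) ⟩
    lookup v i                              ∎
    where open ≡-Reasoning

range : ∀ {M} a k → a + k ≤ M → List (Fin M)
range a k a+k≤M = List.tabulate {n = k} λ i → fromℕ< (≤-trans (+-monoʳ-< a (Fin.toℕ<n i)) a+k≤M)

length-range : ∀ {M} a k (h : a + k ≤ M) → length (range a k h) ≡ k
length-range a k h = List.length-tabulate _

range-unique : ∀ {M} a k (h : a + k ≤ M) → Unique (range a k h)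
range-unique a k h = Unique.tabulate⁺ λ eq → Fin.toℕ-injective (+-cancelˡ-≡ a _ _
  (trans (sym (Fin.toℕ-fromℕ< _)) (trans (cong toℕ eq) (Fin.toℕ-fromℕ< _))))

∈-range⁻ : ∀ {M} a k (h : a + k ≤ M) {w} → w ∈ range a k h → a ≤ toℕ w × toℕ w < a + k
∈-range⁻ a k h w∈ with ∈-tabulate⁻ w∈
... | i , refl rewrite Fin.toℕ-fromℕ< (≤-trans (+-monoʳ-< a (Fin.toℕ<n i)) h) =
  m≤m+n a (toℕ i) , +-monoʳ-< a (Fin.toℕ<n i)

∈-range⁺ : ∀ {M} a k (h : a + k ≤ M) (w : Fin M) → a ≤ toℕ w → toℕ w < a + k → w ∈ range a k h
∈-range⁺ a k h w a≤w w<a+k = subst (_∈ range a k h) w≡ (∈-tabulate⁺ (fromℕ< w∸a<k))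
  where
  w∸a<k : toℕ w ∸ a < k
  w∸a<k = +-cancelˡ-< a _ _ (subst (_< a + k) (sym (m+[n∸m]≡n a≤w)) w<a+k)
  w≡ : fromℕ< (≤-trans (+-monoʳ-< a (Fin.toℕ<n (fromℕ< w∸a<k))) h) ≡ w
  w≡ = Fin.toℕ-injective (trans (Fin.toℕ-fromℕ< _)
         (trans (cong (a +_) (Fin.toℕ-fromℕ< w∸a<k)) (m+[n∸m]≡n a≤w)))

module _ {X Y : Set} (_≟_ : DecidableEquality X) (default : Y) where

  lookupZip : List X → List Y → X → Y
  lookupZip (a ∷ as) (b ∷ bs) k = if does (k ≟ a) then b else lookupZip as bs k
  lookupZip _        _        _ = default

  lookupZip-head : ∀ a as b bs → lookupZip (a ∷ as) (b ∷ bs) a ≡ b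
  lookupZip-head a as b bs with a ≟ a
  ... | yes _ = refl
  ... | no a≢a = ⊥-elim (a≢a refl)

  lookupZip-tail : ∀ {a as b bs k} → k ≢ a → lookupZip (a ∷ as) (b ∷ bs) k ≡ lookupZip as bs k
  lookupZip-tail {a} {k = k} k≢a with k ≟ a
  ... | yes k≡a = ⊥-elim (k≢a k≡a)
  ... | no _ = refl

  lookupZip-∈ : ∀ {as bs k} → length as ≡ length bs → k ∈ as → lookupZip as bs k ∈ bs
  lookupZip-∈ {a ∷ as} {b ∷ bs} {k} eq k∈ with k ≟ a | k∈
  ... | yes _   | _          = here refl
  ... | no k≢a  | here k≡a   = ⊥-elim (k≢a k≡a)
  ... | no _    | there k∈′  = there (lookupZip-∈ (suc-injective eq) k∈′)

  lookupZip-++ˡ : ∀ {as bs k} as′ bs′ → length as ≡ length bs → k ∈ as →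
    lookupZip (as ++ as′) (bs ++ bs′) k ≡ lookupZip as bs k
  lookupZip-++ˡ {a ∷ as} {b ∷ bs} {k} as′ bs′ eq k∈ with k ≟ a | k∈
  ... | yes _   | _          = refl
  ... | no k≢a  | here k≡a   = ⊥-elim (k≢a k≡a)
  ... | no _    | there k∈′  = lookupZip-++ˡ as′ bs′ (suc-injective eq) k∈′

  lookupZip-injective : ∀ {as bs k k′} → Unique as → Unique bs → length as ≡ length bs →
    k ∈ as → k′ ∈ as → lookupZip as bs k ≡ lookupZip as bs k′ → k ≡ k′
  lookupZip-injective {a ∷ as} {b ∷ bs} {k} {k′} (_ ∷ uas) (b∉ ∷ ubs) eq k∈ k′∈ m≡
    with k ≟ a | k′ ≟ a
  ... | yes k≡a | yes k′≡a = trans k≡a (sym k′≡a)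
  ... | yes _   | no k′≢a  =
    ⊥-elim (All¬⇒¬Any b∉ (subst (_∈ bs) (sym m≡)
      (lookupZip-∈ (suc-injective eq) (∈-∷-≢ k′≢a k′∈))))
  ... | no k≢a  | yes _    =
    ⊥-elim (All¬⇒¬Any b∉ (subst (_∈ bs) m≡ (lookupZip-∈ (suc-injective eq) (∈-∷-≢ k≢a k∈))))
  ... | no k≢a  | no k′≢a  =
    lookupZip-injective uas ubs (suc-injective eq) (∈-∷-≢ k≢a k∈) (∈-∷-≢ k′≢a k′∈) m≡

  lookupZip-onto : ∀ {as bs b′} → Unique as → length as ≡ length bs → b′ ∈ bs →
    ∃ λ k → k ∈ as × lookupZip as bs k ≡ b′
  lookupZip-onto {a ∷ as} {b ∷ bs} _ _ (here refl) = a , here refl , lookupZip-head a as b bs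
  lookupZip-onto {a ∷ as} {b ∷ bs} (a∉ ∷ uas) eq (there b′∈)
    with lookupZip-onto uas (suc-injective eq) b′∈
  ... | k , k∈ , m≡ =
    k , there k∈ ,
    trans (lookupZip-tail {as = as} {bs = bs} (λ k≡a → All¬⇒¬Any a∉ (subst (_∈ as) k≡a k∈))) m≡

module _ {n : ℕ} where

  transpose-i : ∀ (i j : Fin n) → transpose i j i ≡ j
  transpose-i i j rewrite dec-true (i Fin.≟ i) refl = refl

  transpose-j : ∀ (i j : Fin n) → transpose i j j ≡ i
  transpose-j i j with j Fin.≟ i
  ... | yes j≡i = j≡i
  ... | no _ rewrite dec-true (j Fin.≟ j) refl = refl

  transpose-other : ∀ {i j k : Fin n} → k ≢ i → k ≢ j → transpose i j k ≡ k
  transpose-other {i} {j} {k} k≢i k≢j rewrite dec-false (k Fin.≟ i) k≢i | dec-false (k Fin.≟ j) k≢j = refl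

nth : X → List X → ℕ → X
nth d []       _       = d
nth d (x ∷ _)  zero    = x
nth d (_ ∷ xs) (suc i) = nth d xs i

nth-lookup : ∀ (d : X) xs (i : Fin (length xs)) → nth d xs (toℕ i) ≡ List.lookup xs i
nth-lookup d (x ∷ xs) Fin.zero    = refl
nth-lookup d (x ∷ xs) (Fin.suc i) = nth-lookup d xs i


private
  variable
    m m′ : ℕ

adj⇒≢ : ∀ (G : Graph) {i j} → adj G i j ≡ true → i ≢ j
adj⇒≢ G {i} aij refl with trans (sym aij) (irrefl G i)
... | ()

-- Copies of F as images of embeddings

-- VSet F G × ESet F G, which depends on G only through its size.
Pair : ℕ → Set
Pair m = Vec Bool m × Vec (Vec Bool m) m

hasVertex : Pair m → Fin m → Bool
hasVertex (S , _) w = lookup S w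

hasEdge : Pair m → Fin m → Fin m → Bool
hasEdge (_ , E) a b = lookup (lookup E a) b

pair-ext : {p q : Pair m} → (∀ w → hasVertex p w ≡ hasVertex q w) →
  (∀ a b → hasEdge p a b ≡ hasEdge q a b) → p ≡ q
pair-ext {p = _ , _} {_ , _} eqV eqE = cong₂ _,_ (vec-ext eqV) (vec-ext λ a → vec-ext (eqE a))

pull : (Fin m′ → Fin m) → Pair m → Pair m′
pull τ (S , E) = tabulate (lookup S ∘ τ) , tabulate λ a → tabulate λ b → lookup (lookup E (τ a)) (τ b)

hasVertex-pull : ∀ (τ : Fin m′ → Fin m) p w → hasVertex (pull τ p) w ≡ hasVertex p (τ w)
hasVertex-pull τ (S , E) w = Vec.lookup∘tabulate _ w

hasEdge-pull : ∀ (τ : Fin m′ → Fin m) p a b → hasEdge (pull τ p) a b ≡ hasEdge p (τ a) (τ b)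
hasEdge-pull τ (S , E) a b =
  trans (cong (λ r → lookup r b) (Vec.lookup∘tabulate _ a)) (Vec.lookup∘tabulate _ b)

record IsEmbedding (F G : Graph) (f : Fin (size F) → Fin (size G)) : Set where
  field
    injective     : Injective _≡_ _≡_ f
    preserves-adj : ∀ {i j} → adj F i j ≡ true → adj G (f i) (f j) ≡ true

module _ (F : Graph) where
  private
    n = size F

  Hits : (Fin n → Fin m) → Fin m → Set
  Hits f w = ∃ λ i → f i ≡ w

  HitsEdge : (Fin n → Fin m) → Fin m → Fin m → Set
  HitsEdge f a b = ∃₂ λ i j → f i ≡ a × f j ≡ b × adj F i j ≡ true

  hits? : (f : Fin n → Fin m) → ∀ w → Dec (Hits f w)
  hits? f w = any? λ i → f i Fin.≟ w

  hitsEdge? : (f : Fin n → Fin m) → ∀ a b → Dec (HitsEdge f a b)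
  hitsEdge? f a b = any? λ i → any? λ j → (f i Fin.≟ a) ×-dec (f j Fin.≟ b) ×-dec (adj F i j ≟ᵇ true)

  image : (Fin n → Fin m) → Pair m
  image f = tabulate (does ∘ hits? f) , tabulate λ a → tabulate λ b → does (hitsEdge? f a b)

  module _ (f : Fin n → Fin m) where

    image-hasVertex⁺ : ∀ {w} → Hits f w → hasVertex (image f) w ≡ true
    image-hasVertex⁺ {w} h = trans (Vec.lookup∘tabulate _ w) (dec-true (hits? f w) h)

    image-hasVertex⁻ : ∀ {w} → hasVertex (image f) w ≡ true → Hits f w
    image-hasVertex⁻ {w} e = does-true⇒ (hits? f w) (trans (sym (Vec.lookup∘tabulate _ w)) e)

    private
      hasEdge-image : ∀ a b → hasEdge (image f) a b ≡ does (hitsEdge? f a b)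
      hasEdge-image a b = trans (cong (λ r → lookup r b) (Vec.lookup∘tabulate _ a)) (Vec.lookup∘tabulate _ b)

    image-hasEdge⁺ : ∀ {a b} → HitsEdge f a b → hasEdge (image f) a b ≡ true
    image-hasEdge⁺ {a} {b} h = trans (hasEdge-image a b) (dec-true (hitsEdge? f a b) h)

    image-hasEdge⁻ : ∀ {a b} → hasEdge (image f) a b ≡ true → HitsEdge f a b
    image-hasEdge⁻ {a} {b} e = does-true⇒ (hitsEdge? f a b) (trans (sym (hasEdge-image a b)) e)

  image-≡ : {f g : Fin n → Fin m} →
    (∀ {w} → Hits f w → Hits g w) → (∀ {w} → Hits g w → Hits f w) →
    (∀ {a b} → HitsEdge f a b → HitsEdge g a b) → (∀ {a b} → HitsEdge g a b → HitsEdge f a b) →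
    image f ≡ image g
  image-≡ {f = f} {g} f⇒g g⇒f fE⇒gE gE⇒fE = pair-ext
    (λ w → Bool-ext (image-hasVertex⁺ g ∘ f⇒g ∘ image-hasVertex⁻ f)
                    (image-hasVertex⁺ f ∘ g⇒f ∘ image-hasVertex⁻ g))
    (λ a b → Bool-ext (image-hasEdge⁺ g ∘ fE⇒gE ∘ image-hasEdge⁻ f)
                      (image-hasEdge⁺ f ∘ gE⇒fE ∘ image-hasEdge⁻ g))

  image-≗ : {f g : Fin n → Fin m} → (∀ i → f i ≡ g i) → image f ≡ image g
  image-≗ f≗g = image-≡
    (λ (i , e) → i , trans (sym (f≗g i)) e) (λ (i , e) → i , trans (f≗g i) e)
    (λ (i , j , ei , ej , a) → i , j , trans (sym (f≗g i)) ei , trans (sym (f≗g j)) ej , a)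
    (λ (i , j , ei , ej , a) → i , j , trans (f≗g i) ei , trans (f≗g j) ej , a)

  image-∘-cong : ∀ {m m′} (σ : Fin m → Fin m′) {f g : Fin n → Fin m} →
    image f ≡ image g → image (σ ∘ f) ≡ image (σ ∘ g)
  image-∘-cong {m} σ f≡g = image-≡ (vertices f≡g) (vertices (sym f≡g)) (edges f≡g) (edges (sym f≡g))
    where
    vertices : ∀ {f g : Fin n → Fin m} {w} → image f ≡ image g → Hits (σ ∘ f) w → Hits (σ ∘ g) w
    vertices {f} {g} f≡g (i , e) with image-hasVertex⁻ g (subst (λ p → hasVertex p (f i) ≡ true) f≡g
                                                         (image-hasVertex⁺ f (i , refl)))
    ... | j , gj≡fi = j , trans (cong σ gj≡fi) e
    edges : ∀ {f g : Fin n → Fin m} {a b} → image f ≡ image g →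
      HitsEdge (σ ∘ f) a b → HitsEdge (σ ∘ g) a b
    edges {f} {g} f≡g (i , j , ei , ej , aij)
      with image-hasEdge⁻ g (subst (λ p → hasEdge p (f i) (f j) ≡ true) f≡g
                               (image-hasEdge⁺ f (i , j , refl , refl , aij)))
    ... | i′ , j′ , gi′≡fi , gj′≡fj , ai′j′ =
      i′ , j′ , trans (cong σ gi′≡fi) ei , trans (cong σ gj′≡fj) ej , ai′j′

  module _ {τ : Fin m′ → Fin m} (τ-injective : Injective _≡_ _≡_ τ) where

    pull-image : {f : Fin n → Fin m} {g : Fin n → Fin m′} → (∀ i → τ (g i) ≡ f i) →
      pull τ (image f) ≡ image g
    pull-image {f} {g} τ∘g≗f = pair-ext
      (λ w → trans (hasVertex-pull τ (image f) w) (Bool-ext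
        (λ e → let (i , fi≡) = image-hasVertex⁻ f e in
               image-hasVertex⁺ g (i , τ-injective (trans (τ∘g≗f i) fi≡)))
        (λ e → let (i , gi≡) = image-hasVertex⁻ g e in
               image-hasVertex⁺ f (i , trans (sym (τ∘g≗f i)) (cong τ gi≡)))))
      (λ a b → trans (hasEdge-pull τ (image f) a b) (Bool-ext
        (λ e → let (i , j , ei , ej , aij) = image-hasEdge⁻ f e in
               image-hasEdge⁺ g (i , j , τ-injective (trans (τ∘g≗f i) ei) ,
                                         τ-injective (trans (τ∘g≗f j) ej) , aij))
        (λ e → let (i , j , ei , ej , aij) = image-hasEdge⁻ g e in
               image-hasEdge⁺ f (i , j , trans (sym (τ∘g≗f i)) (cong τ ei) ,
                                         trans (sym (τ∘g≗f j)) (cong τ ej) , aij))))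

module _ (F G : Graph) where

  image-isCopy : ∀ {f v} → IsEmbedding F G f → Hits F f v → IsFCopyAt F G v (image F f)
  image-isCopy {f} {v} f-emb v-hit =
    (edge⇒adj , edge-sym , edge⇒vertex) , (tabulate f , isIso) , image-hasVertex⁺ F f v-hit
    where
    open IsEmbedding f-emb
    lookup-f : ∀ i → lookup (tabulate f) i ≡ f i
    lookup-f = Vec.lookup∘tabulate f
    edge⇒adj : ∀ a b → hasEdge (image F f) a b ≡ true → adj G a b ≡ true
    edge⇒adj a b e with image-hasEdge⁻ F f e
    ... | i , j , refl , refl , aij = preserves-adj aij
    edge-flip : ∀ a b → hasEdge (image F f) a b ≡ true → hasEdge (image F f) b a ≡ true
    edge-flip a b e with image-hasEdge⁻ F f e
    ... | i , j , ei , ej , aij = image-hasEdge⁺ F f (j , i , ej , ei , trans (Graph.sym F j i) aij)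
    edge-sym : ∀ a b → hasEdge (image F f) a b ≡ hasEdge (image F f) b a
    edge-sym a b = Bool-ext (edge-flip a b) (edge-flip b a)
    edge⇒vertex : ∀ a b → hasEdge (image F f) a b ≡ true → hasVertex (image F f) a ≡ true
    edge⇒vertex a b e with image-hasEdge⁻ F f e
    ... | i , _ , ei , _ = image-hasVertex⁺ F f (i , ei)
    isIso : IsIso F G (proj₁ (image F f)) (proj₂ (image F f)) (tabulate f)
    isIso = (λ i j e → injective (trans (sym (lookup-f i)) (trans e (lookup-f j))))
          , (λ i → image-hasVertex⁺ F f (i , sym (lookup-f i)))
          , (λ w e → let (i , fi≡w) = image-hasVertex⁻ F f e in i , trans (lookup-f i) fi≡w)
          , λ i j → Bool-ext
              (λ aij → image-hasEdge⁺ F f (i , j , sym (lookup-f i) , sym (lookup-f j) , aij))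
              (λ e → let (i′ , j′ , ei′ , ej′ , ai′j′) = image-hasEdge⁻ F f e in
                     subst₂ (λ x y → adj F x y ≡ true)
                       (injective (trans ei′ (lookup-f i))) (injective (trans ej′ (lookup-f j))) ai′j′)

  isCopy-edge⇒adj : ∀ {v} p → IsFCopyAt F G v p → ∀ {a b} → hasEdge p a b ≡ true → adj G a b ≡ true
  isCopy-edge⇒adj (S , E) ((edge⇒adj , _) , _) = edge⇒adj _ _

  record Presentation (v : Fin (size G)) (p : Pair (size G)) : Set where
    field
      emb         : Fin (size F) → Fin (size G)
      isEmbedding : IsEmbedding F G emb
      p≡image     : p ≡ image F emb
      hits-v      : Hits F emb v

  isCopy⇒presentation : ∀ {v} p → IsFCopyAt F G v p → Presentation v p
  isCopy⇒presentation {v} (S , E)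
    ((edge⇒adj , edge-sym , edge⇒vertex) , (φ , (φ-inj , φ∈S , S⊆φ , adj≡edge)) , v∈S) = record
    { emb         = lookup φ
    ; isEmbedding = record
      { injective     = λ {i} {j} → φ-inj i j
      ; preserves-adj = λ {i} {j} aij → edge⇒adj _ _ (trans (sym (adj≡edge i j)) aij) }
    ; p≡image     = pair-ext vertices edges
    ; hits-v      = S⊆φ v v∈S }
    where
    vertices : ∀ w → lookup S w ≡ hasVertex (image F (lookup φ)) w
    vertices w = Bool-ext (image-hasVertex⁺ F _ ∘ S⊆φ w) λ e →
      let (i , φi≡w) = image-hasVertex⁻ F _ e in subst (λ x → lookup S x ≡ true) φi≡w (φ∈S i)
    edges : ∀ a b → lookup (lookup E a) b ≡ hasEdge (image F (lookup φ)) a b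
    edges a b = Bool-ext to from
      where
      to : lookup (lookup E a) b ≡ true → hasEdge (image F (lookup φ)) a b ≡ true
      to e with S⊆φ a (edge⇒vertex a b e) | S⊆φ b (edge⇒vertex b a (trans (sym (edge-sym a b)) e))
      ... | i , refl | j , refl = image-hasEdge⁺ F (lookup φ) (i , j , refl , refl , trans (adj≡edge i j) e)
      from : hasEdge (image F (lookup φ)) a b ≡ true → lookup (lookup E a) b ≡ true
      from e with image-hasEdge⁻ F (lookup φ) e
      ... | i , j , refl , refl , aij = trans (sym (adj≡edge i j)) aij

module _ (F G G′ : Graph) {τ : Fin (size G′) → Fin (size G)} (τ-injective : Injective _≡_ _≡_ τ) where

  pull-isCopy : ∀ {v p} (P : Presentation F G v p) {g : Fin (size F) → Fin (size G′)} {v′} →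
    IsEmbedding F G′ g → (∀ i → τ (g i) ≡ Presentation.emb P i) → τ v′ ≡ v →
    IsFCopyAt F G′ v′ (pull τ p)
  pull-isCopy P {g} g-emb τ∘g≗f τv′≡v =
    subst (IsFCopyAt F G′ _) (sym (trans (cong (pull τ) p≡image) (pull-image F τ-injective τ∘g≗f)))
      (image-isCopy F G′ g-emb (let (i , fi≡v) = hits-v in
                                 i , τ-injective (trans (τ∘g≗f i) (trans fi≡v (sym τv′≡v)))))
    where open Presentation P

  pull-injective : ∀ {v p q} (P : Presentation F G v p) (Q : Presentation F G v q)
    {g g′ : Fin (size F) → Fin (size G′)} → (∀ i → τ (g i) ≡ Presentation.emb P i) →
    (∀ i → τ (g′ i) ≡ Presentation.emb Q i) → pull τ p ≡ pull τ q → p ≡ q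
  pull-injective {p = p} {q} P Q {g} {g′} τ∘g≗f τ∘g′≗f′ eq = begin
    p               ≡⟨ P.p≡image ⟩
    image F P.emb   ≡⟨ image-≗ F τ∘g≗f ⟨
    image F (τ ∘ g) ≡⟨ image-∘-cong F τ (begin
                         image F g                ≡⟨ pull-image F τ-injective τ∘g≗f ⟨
                         pull τ (image F P.emb)   ≡⟨ cong (pull τ) P.p≡image ⟨
                         pull τ p                 ≡⟨ eq ⟩
                         pull τ q                 ≡⟨ cong (pull τ) Q.p≡image ⟩
                         pull τ (image F Q.emb)   ≡⟨ pull-image F τ-injective τ∘g′≗f′ ⟩
                         image F g′               ∎) ⟩
    image F (τ ∘ g′) ≡⟨ image-≗ F τ∘g′≗f′ ⟩
    image F Q.emb   ≡⟨ Q.p≡image ⟨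
    q               ∎
    where
    open ≡-Reasoning
    module P = Presentation P
    module Q = Presentation Q

∈-allVecs : ∀ {X : Set} (xs : List X) k (v : Vec X k) → (∀ i → lookup v i ∈ xs) → v ∈ allVecs xs k
∈-allVecs xs zero    Vec.[]       _ = here refl
∈-allVecs xs (suc k) (a Vec.∷ v) h =
  subst (_ ∈_) (sym (concatMap-map≡cartesianProductWith Vec._∷_ xs (allVecs xs k)))
    (∈-cartesianProductWith⁺ Vec._∷_ (h Fin.zero) (∈-allVecs xs k v (h ∘ Fin.suc)))

allVecs-unique : ∀ {X : Set} {xs : List X} k → Unique xs → Unique (allVecs xs k)
allVecs-unique zero    _ = Unique-∷ (λ ()) []
allVecs-unique {xs = xs} (suc k) u =
  subst Unique (sym (concatMap-map≡cartesianProductWith Vec._∷_ xs (allVecs xs k)))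
    (Unique.cartesianProductWith⁺ Vec._∷_ Vec.∷-injective u (allVecs-unique k u))

∈-bools : ∀ b → b ∈ bools
∈-bools true  = here refl
∈-bools false = there (here refl)

bools-unique : Unique bools
bools-unique = Unique-∷ (λ { (here ()) ; (there ()) }) (Unique-∷ (λ ()) [])

module _ (F G : Graph) where

  allPairs≡ : allPairs F G ≡ cartesianProduct (allVecs bools (size G)) (allVecs (allVecs bools (size G)) (size G))
  allPairs≡ = concatMap-map≡cartesianProductWith _,_ (allVecs bools (size G))
                (allVecs (allVecs bools (size G)) (size G))

  ∈-allPairs : (p : Pair (size G)) → p ∈ allPairs F G
  ∈-allPairs (S , E) = subst (_ ∈_) (sym allPairs≡) (∈-cartesianProduct⁺
    (∈-allVecs bools _ S (∈-bools ∘ lookup S))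
    (∈-allVecs (allVecs bools (size G)) (size G) E λ a →
      ∈-allVecs bools (size G) (lookup E a) (∈-bools ∘ lookup (lookup E a))))

  allPairs-unique : Unique (allPairs F G)
  allPairs-unique = subst Unique (sym allPairs≡)
    (Unique.cartesianProduct⁺ (allVecs-unique _ bools-unique) (allVecs-unique _ (allVecs-unique _ bools-unique)))

HasVertex : Fin m → Pair m → Set
HasVertex w p = hasVertex p w ≡ true

hasVertex? : (w : Fin m) → (p : Pair m) → Dec (HasVertex w p)
hasVertex? w p = hasVertex p w ≟ᵇ true

module _ (F G : Graph) where

  copiesWith copiesWithout : Fin (size G) → Fin (size G) → List (Pair (size G))
  copiesWith    v w = filter (isFCopyAt? F G v ∩? hasVertex? w) (allPairs F G)
  copiesWithout v w = filter (isFCopyAt? F G v ∩? ∁? (hasVertex? w)) (allPairs F G)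

  FDegree-split : ∀ v w → FDegree F G v ≡ length (copiesWith v w) + length (copiesWithout v w)
  FDegree-split v w = length-filter-split (isFCopyAt? F G v) (hasVertex? w) (allPairs F G)

  length-copiesWith-comm : ∀ v w → length (copiesWith v w) ≡ length (copiesWith w v)
  length-copiesWith-comm v w = cong length (List.filter-≐ (isFCopyAt? F G v ∩? hasVertex? w)
    (isFCopyAt? F G w ∩? hasVertex? v) ((λ {p} → exchange {v} {w} {p}) , (λ {p} → exchange {w} {v} {p}))
    (allPairs F G))
    where
    exchange : ∀ {v w} {p : Pair (size G)} →
      IsFCopyAt F G v p × HasVertex w p → IsFCopyAt F G w p × HasVertex v p
    exchange {p = S , E} ((sub , iso , v∈) , w∈) = (sub , iso , w∈) , v∈

  copiesWith-unique : ∀ v w → Unique (copiesWith v w)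
  copiesWith-unique v w = Unique.filter⁺ _ (allPairs-unique F G)

  copiesWithout-unique : ∀ v w → Unique (copiesWithout v w)
  copiesWithout-unique v w = Unique.filter⁺ _ (allPairs-unique F G)

  ∈-copiesWith⁺ : ∀ {v w} p → IsFCopyAt F G v p → HasVertex w p → p ∈ copiesWith v w
  ∈-copiesWith⁺ {v} {w} p p-copy w∈p =
    ∈-filter⁺ (isFCopyAt? F G v ∩? hasVertex? w) (∈-allPairs F G p) (p-copy , w∈p)

  ∈-copiesWith⁻ : ∀ {v w p} → p ∈ copiesWith v w → IsFCopyAt F G v p × HasVertex w p
  ∈-copiesWith⁻ {v} {w} p∈ =
    proj₂ (∈-filter⁻ (isFCopyAt? F G v ∩? hasVertex? w) {xs = allPairs F G} p∈)

  ∈-copiesWithout⁺ : ∀ {v w} p → IsFCopyAt F G v p → ¬ HasVertex w p → p ∈ copiesWithout v w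
  ∈-copiesWithout⁺ {v} {w} p p-copy w∉p =
    ∈-filter⁺ (isFCopyAt? F G v ∩? ∁? (hasVertex? w)) (∈-allPairs F G p) (p-copy , w∉p)

  ∈-copiesWithout⁻ : ∀ {v w p} → p ∈ copiesWithout v w → IsFCopyAt F G v p × ¬ HasVertex w p
  ∈-copiesWithout⁻ {v} {w} p∈ =
    proj₂ (∈-filter⁻ (isFCopyAt? F G v ∩? ∁? (hasVertex? w)) {xs = allPairs F G} p∈)

module _ (F G : Graph) {x y : Fin (size F)} (xy : adj F x y ≡ true) where
  private
    n = size F

    other? : (k : Fin n) → Dec (k ≢ x × k ≢ y)
    other? k = ¬? (k Fin.≟ x) ×-dec ¬? (k Fin.≟ y)

    others : List (Fin n)
    others = filter other? (List.allFin n)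

  edgeFirst : List (Fin n)
  edgeFirst = x ∷ y ∷ others

  edgeFirst-unique : Unique edgeFirst
  edgeFirst-unique = Unique-∷ x∉ (Unique-∷ y∉ (Unique.filter⁺ other? (Unique.allFin⁺ n)))
    where
    x∉ : x ∉ y ∷ others
    x∉ (here x≡y)  = adj⇒≢ F xy x≡y
    x∉ (there x∈) = proj₁ (proj₂ (∈-filter⁻ other? {xs = List.allFin n} x∈)) refl
    y∉ : y ∉ others
    y∉ y∈ = proj₂ (proj₂ (∈-filter⁻ other? {xs = List.allFin n} y∈)) refl

  ∈-edgeFirst : ∀ k → k ∈ edgeFirst
  ∈-edgeFirst k with k Fin.≟ x | k Fin.≟ y
  ... | yes refl | _        = here refl
  ... | no _     | yes refl = there (here refl)
  ... | no k≢x   | no k≢y   = there (there (∈-filter⁺ other? (∈-allFin k) (k≢x , k≢y)))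

  length-edgeFirst : length edgeFirst ≡ n
  length-edgeFirst = length-of-complete edgeFirst-unique ∈-edgeFirst

  cliqueEmbedding : Fin (size G) → Fin (size G) → List (Fin (size G)) → Fin n → Fin (size G)
  cliqueEmbedding a b X = lookupZip Fin._≟_ a edgeFirst (a ∷ b ∷ X)

  module CliqueEmbedding {a b : Fin (size G)} {X : List (Fin (size G))} (W-unique : Unique (a ∷ b ∷ X))
           (W-length : 2 + length X ≡ n)
           (W-clique : ∀ {c d} → c ∈ a ∷ b ∷ X → d ∈ a ∷ b ∷ X → c ≢ d → adj G c d ≡ true) where
    private
      f = cliqueEmbedding a b X
      length≡ : length edgeFirst ≡ length (a ∷ b ∷ X)
      length≡ = trans length-edgeFirst (sym W-length)

    cliqueEmbedding-x : f x ≡ a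
    cliqueEmbedding-x = lookupZip-head Fin._≟_ a x (y ∷ others) a (b ∷ X)

    cliqueEmbedding-y : f y ≡ b
    cliqueEmbedding-y = trans (lookupZip-tail Fin._≟_ a {as = y ∷ others} {bs = b ∷ X} (adj⇒≢ F xy ∘ sym))
                              (lookupZip-head Fin._≟_ a y others b X)

    cliqueEmbedding-∈ : ∀ k → f k ∈ a ∷ b ∷ X
    cliqueEmbedding-∈ k = lookupZip-∈ Fin._≟_ a length≡ (∈-edgeFirst k)

    cliqueEmbedding-onto : ∀ {w} → w ∈ a ∷ b ∷ X → Hits F f w
    cliqueEmbedding-onto w∈ =
      let (k , _ , fk≡w) = lookupZip-onto Fin._≟_ a edgeFirst-unique length≡ w∈ in k , fk≡w

    cliqueEmbedding-isEmbedding : IsEmbedding F G f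
    cliqueEmbedding-isEmbedding = record
      { injective     = injective
      ; preserves-adj = λ {i} {j} aij → W-clique (cliqueEmbedding-∈ i) (cliqueEmbedding-∈ j)
                                          (adj⇒≢ F aij ∘ injective) }
      where
      injective : Injective _≡_ _≡_ f
      injective = lookupZip-injective Fin._≟_ a edgeFirst-unique W-unique length≡
                    (∈-edgeFirst _) (∈-edgeFirst _)


private
  T⇒≡ : ∀ {b} → T b → b ≡ true
  T⇒≡ = Equivalence.to T-≡

  ≡⇒T : ∀ {b} → b ≡ true → T b
  ≡⇒T = Equivalence.from T-≡

  T-∧⁻ : ∀ x {y} → T (x ∧ y) → T x × T y
  T-∧⁻ x = Equivalence.to (T-∧ {x})

  T-∨⁻ : ∀ x {y} → T (x ∨ y) → T x ⊎ T y
  T-∨⁻ x = Equivalence.to (T-∨ {x})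

Near : ℕ → ℕ → ℕ → Set
Near d a b = a ≤ b + d × b ≤ a + d

Near-sym : ∀ {d a b} → Near d a b → Near d b a
Near-sym (a≤ , b≤) = b≤ , a≤

absDiff-≤⇒Near : ∀ {d} a b → absDiff a b ≤ d → Near d a b
absDiff-≤⇒Near a b h =
  ≤-trans (m≤n+m∸n a b) (+-monoʳ-≤ b (≤-trans (m≤m+n (a ∸ b) (b ∸ a)) h)) ,
  ≤-trans (m≤n+m∸n b a) (+-monoʳ-≤ a (≤-trans (m≤n+m (b ∸ a) (a ∸ b)) h))

Near⇒absDiff-≤ : ∀ {d} a b → Near d a b → absDiff a b ≤ d
Near⇒absDiff-≤ a b (a≤ , b≤) with ≤-total a b
... | inj₁ a≤b rewrite m≤n⇒m∸n≡0 a≤b = m≤n+o⇒m∸n≤o b a b≤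
... | inj₂ b≤a rewrite m≤n⇒m∸n≡0 b≤a | +-identityʳ (a ∸ b) = m≤n+o⇒m∸n≤o a b a≤

<⇒≤∸1 : ∀ {m n} → m < n → m ≤ n ∸ 1
<⇒≤∸1 {n = suc n} (s≤s m≤n) = m≤n

symAdj : (ℕ → ℕ → Bool) → ℕ → ℕ → Bool
symAdj r a b = not (a ≡ᵇ b) ∧ (r a b ∨ r b a)

symAdj⁺ : ∀ r {a b} → a ≢ b → T (r a b) → T (symAdj r a b)
symAdj⁺ r {a} {b} a≢b rab with a ≡ᵇ b in eq
... | true  = ⊥-elim (a≢b (≡ᵇ⇒≡ a b (≡⇒T eq)))
... | false = Equivalence.from T-∨ (inj₁ rab)

symAdj⁻ : ∀ r {a b} → T (symAdj r a b) → T (r a b) ⊎ T (r b a)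
symAdj⁻ r {a} {b} h = T-∨⁻ (r a b) (proj₂ (T-∧⁻ (not (a ≡ᵇ b)) h))

symGraph-adj⁺ : ∀ {k} r {i j : Fin k} → i ≢ j → T (r (toℕ i) (toℕ j)) →
  adj (symGraph k r) i j ≡ true
symGraph-adj⁺ r i≢j rij = T⇒≡ (symAdj⁺ r (i≢j ∘ Fin.toℕ-injective) rij)

symGraph-adj⁻ : ∀ {k} r {i j : Fin k} → adj (symGraph k r) i j ≡ true →
  T (r (toℕ i) (toℕ j)) ⊎ T (r (toℕ j) (toℕ i))
symGraph-adj⁻ r aij = symAdj⁻ r (≡⇒T aij)

A-rel : ℕ → ℕ → ℕ → Bool
A-rel d a b = absDiff a b ≤ᵇ d

module _ (l : ℕ) (i j : Fin (2 * l ∸ 1)) where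

  adjA⁺ : i ≢ j → Near (l ∸ 1) (toℕ i) (toℕ j) → adj (A l) i j ≡ true
  adjA⁺ i≢j near = symGraph-adj⁺ (A-rel (l ∸ 1)) i≢j (≤⇒≤ᵇ (Near⇒absDiff-≤ _ _ near))

  adjA⁻ : adj (A l) i j ≡ true → Near (l ∸ 1) (toℕ i) (toℕ j)
  adjA⁻ aij with symGraph-adj⁻ (A-rel (l ∸ 1)) {i} {j} aij
  ... | inj₁ rij = absDiff-≤⇒Near _ _ (≤ᵇ⇒≤ _ _ rij)
  ... | inj₂ rji = Near-sym (absDiff-≤⇒Near _ _ (≤ᵇ⇒≤ _ _ rji))

Fgraph-rel : ℕ → ℕ → ℕ → ℕ → ℕ → Bool
Fgraph-rel N d t a b = ((a <ᵇ N) ∧ (b <ᵇ N) ∧ A-rel d a b) ∨ ((a ≡ᵇ N) ∧ (b <ᵇ t))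

Fgraph-rel-below : ∀ {N d t a b} → a < N → b < N → Fgraph-rel N d t a b ≡ A-rel d a b
Fgraph-rel-below {N} {d} {t} {a} {b} a<N b<N with a ≡ᵇ N in a≡ᵇN
... | true  = ⊥-elim (<⇒≢ a<N (≡ᵇ⇒≡ a N (≡⇒T a≡ᵇN)))
... | false rewrite T⇒≡ (<⇒<ᵇ a<N) | T⇒≡ (<⇒<ᵇ b<N) = ∨-identityʳ (A-rel d a b)

Fgraph-rel-from-last : ∀ {N d t b} → T (Fgraph-rel N d t N b) → b < t
Fgraph-rel-from-last {N} {d} {t} {b} h with T-∨⁻ ((N <ᵇ N) ∧ (b <ᵇ N) ∧ A-rel d N b) h
... | inj₁ h₁ = ⊥-elim (<-irrefl refl (<ᵇ⇒< N N (proj₁ (T-∧⁻ (N <ᵇ N) h₁))))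
... | inj₂ h₂ = <ᵇ⇒< b t (proj₂ (T-∧⁻ (N ≡ᵇ N) h₂))

Fgraph-rel-to-last : ∀ {N d t b} → T (Fgraph-rel N d t b N) → b ≡ N
Fgraph-rel-to-last {N} {d} {t} {b} h with T-∨⁻ ((b <ᵇ N) ∧ (N <ᵇ N) ∧ A-rel d b N) h
... | inj₁ h₁ = ⊥-elim (<-irrefl refl
                  (<ᵇ⇒< N N (proj₁ (T-∧⁻ (N <ᵇ N) (proj₂ (T-∧⁻ (b <ᵇ N) h₁))))))
... | inj₂ h₂ = ≡ᵇ⇒≡ b N (proj₁ (T-∧⁻ (b ≡ᵇ N) h₂))

module _ (l′ t : ℕ) where
  private
    l = suc l′
    M = 2 * l ∸ 1

  last : Fin (2 * l)
  last = fromℕ M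

  adjF-inject₁ : ∀ (i j : Fin M) → adj (Fgraph l t) (inject₁ i) (inject₁ j) ≡ adj (A l) i j
  adjF-inject₁ i j rewrite Fin.toℕ-inject₁ i | Fin.toℕ-inject₁ j =
    cong₂ (λ x y → not (toℕ i ≡ᵇ toℕ j) ∧ (x ∨ y))
      (Fgraph-rel-below {t = t} (Fin.toℕ<n i) (Fin.toℕ<n j))
      (Fgraph-rel-below {t = t} (Fin.toℕ<n j) (Fin.toℕ<n i))

  adjF-last⁺ : ∀ {b : Fin (2 * l)} → toℕ b < t → b ≢ last → adj (Fgraph l t) last b ≡ true
  adjF-last⁺ {b} b<t b≢last = symGraph-adj⁺ (Fgraph-rel M (l ∸ 1) t) (b≢last ∘ sym)
    (subst (λ x → T (Fgraph-rel M (l ∸ 1) t x (toℕ b))) (sym (Fin.toℕ-fromℕ M))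
      (Equivalence.from (T-∨ {(M <ᵇ M) ∧ (toℕ b <ᵇ M) ∧ A-rel (l ∸ 1) M (toℕ b)})
        (inj₂ (Equivalence.from (T-∧ {M ≡ᵇ M}) (≡⇒≡ᵇ M M refl , <⇒<ᵇ b<t)))))

  adjF-last⁻ : ∀ {b : Fin (2 * l)} → adj (Fgraph l t) last b ≡ true → toℕ b < t
  adjF-last⁻ {b} a with symGraph-adj⁻ (Fgraph-rel M (l ∸ 1) t) {last} {b} a
  ... | inj₁ h = Fgraph-rel-from-last {M} {l ∸ 1}
    (subst (λ x → T (Fgraph-rel M (l ∸ 1) t x (toℕ b))) (Fin.toℕ-fromℕ M) h)
  ... | inj₂ h = ⊥-elim (adj⇒≢ (Fgraph l t) a (sym (Fin.toℕ-injective (trans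
      (Fgraph-rel-to-last {M} {l ∸ 1} {t}
        (subst (λ x → T (Fgraph-rel M (l ∸ 1) t (toℕ b) x)) (Fin.toℕ-fromℕ M) h))
      (sym (Fin.toℕ-fromℕ M))))))

  adjF-below⁺ : ∀ (a b : Fin (2 * l)) → toℕ a < M → toℕ b < M → a ≢ b →
    Near (l ∸ 1) (toℕ a) (toℕ b) → adj (Fgraph l t) a b ≡ true
  adjF-below⁺ a b a<M b<M a≢b near = symGraph-adj⁺ (Fgraph-rel M (l ∸ 1) t) a≢b
    (subst T (sym (Fgraph-rel-below {t = t} a<M b<M)) (≤⇒≤ᵇ (Near⇒absDiff-≤ _ _ near)))

  adjF-below⁻ : ∀ (a b : Fin (2 * l)) → toℕ a < M → toℕ b < M → adj (Fgraph l t) a b ≡ true →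
    Near (l ∸ 1) (toℕ a) (toℕ b)
  adjF-below⁻ a b a<M b<M aab with symGraph-adj⁻ (Fgraph-rel M (l ∸ 1) t) {a} {b} aab
  ... | inj₁ h = absDiff-≤⇒Near _ _ (≤ᵇ⇒≤ _ _ (subst T (Fgraph-rel-below {t = t} a<M b<M) h))
  ... | inj₂ h = Near-sym (absDiff-≤⇒Near _ _ (≤ᵇ⇒≤ _ _ (subst T (Fgraph-rel-below {t = t} b<M a<M) h)))

module _ (F : Graph) where

  neighbours : Fin (size F) → List (Fin (size F))
  neighbours x = filter (λ k → adj F x k ≟ᵇ true) (allFin (size F))

  neighbours-unique : ∀ x → Unique (neighbours x)
  neighbours-unique x = Unique.filter⁺ _ (Unique.allFin⁺ (size F))

  ∈-neighbours⁺ : ∀ {x k} → adj F x k ≡ true → k ∈ neighbours x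
  ∈-neighbours⁺ {x} {k} = ∈-filter⁺ (λ k → adj F x k ≟ᵇ true) (∈-allFin k)

  ∈-neighbours⁻ : ∀ {x k} → k ∈ neighbours x → adj F x k ≡ true
  ∈-neighbours⁻ {x} k∈ = proj₂ (∈-filter⁻ (λ k → adj F x k ≟ᵇ true) {xs = allFin (size F)} k∈)

  degree+2≤size : ∀ {p q} → p ≢ q → adj F p q ≡ false → degree F p + 2 ≤ size F
  degree+2≤size {p} {q} p≢q apq = subst₂ _≤_ (List.length-++ (neighbours p)) (length-allFin (size F))
    (length-≤-of-⊆ unique (λ {k} _ → ∈-allFin k))
    where
    p∉ : ∀ {k} → k ∈ neighbours p → k ≢ p
    p∉ k∈ refl with trans (sym (∈-neighbours⁻ k∈)) (irrefl F p)
    ... | ()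
    q∉ : ∀ {k} → k ∈ neighbours p → k ≢ q
    q∉ k∈ refl with trans (sym (∈-neighbours⁻ k∈)) apq
    ... | ()
    unique : Unique (neighbours p ++ p ∷ q ∷ [])
    unique = Unique.++⁺ (neighbours-unique p)
      (Unique-∷ (λ { (here p≡q) → p≢q p≡q ; (there ()) }) (Unique-∷ (λ ()) []))
      λ { (k∈ , here refl) → p∉ k∈ refl ; (k∈ , there (here refl)) → q∉ k∈ refl }

module _ (F : Graph) (diam : HasDiameter2 F) where

  another-vertex : ∀ a → ∃ λ b → b ≢ a
  another-vertex a with proj₂ diam
  ... | p , q , p≢q , _ with p Fin.≟ a
  ...   | yes refl = q , p≢q ∘ sym
  ...   | no p≢a   = p , p≢a

  has-neighbour : ∀ a → ∃ λ c → adj F a c ≡ true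
  has-neighbour a with another-vertex a
  ... | b , b≢a with adj F a b in aab
  ...   | true  = b , aab
  ...   | false = let (c , aac , _) = proj₁ diam a b (b≢a ∘ sym) aab in c , aac

  module _ (t : ℕ) (mindeg : IsMinDegree F t) where

    minDegree+2≤size : t + 2 ≤ size F
    minDegree+2≤size with proj₂ diam
    ... | p , q , p≢q , apq = ≤-trans (+-monoˡ-≤ 2 (proj₂ mindeg p)) (degree+2≤size F p≢q apq)

    1≤minDegree : 1 ≤ t
    1≤minDegree with proj₁ mindeg
    ... | x , deg≡t = subst (1 ≤_) deg≡t (∈-length (∈-neighbours⁺ F (proj₂ (has-neighbour x))))

-- The gap z_{i+1} - z_i

Near-suc : ∀ {d c b} → suc c ≤ d → Near d c b → Near d (suc c) b
Near-suc {d} {c} {b} c<d (_ , b≤c+d) = ≤-trans c<d (m≤n+m d b) , ≤-trans b≤c+d (+-monoˡ-≤ d (n≤1+n c))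

c+l<2l∸1 : ∀ {c l} → suc c < l → c + l < 2 * l ∸ 1
c+l<2l∸1 {c} {suc l} (s≤s c<l) = begin-strict
  c + suc l          <⟨ n<1+n _ ⟩
  suc c + suc l      ≤⟨ +-monoˡ-≤ (suc l) c<l ⟩
  l + suc l          ≡⟨ cong (λ z → l + suc z) (+-identityʳ l) ⟨
  l + suc (l + 0)    ∎
  where open ≤-Reasoning

2+c+[l∸2]≡c+l : ∀ {c l} → 2 ≤ l → 2 + c + (l ∸ 2) ≡ c + l
2+c+[l∸2]≡c+l {c} {l} 2≤l = begin
  2 + c + (l ∸ 2)    ≡⟨ cong (_+ (l ∸ 2)) (+-comm 2 c) ⟩
  c + 2 + (l ∸ 2)    ≡⟨ +-assoc c 2 (l ∸ 2) ⟩
  c + (2 + (l ∸ 2))  ≡⟨ cong (c +_) (m+[n∸m]≡n 2≤l) ⟩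
  c + l              ∎
  where open ≡-Reasoning

module _ (F : Graph) (l : ℕ) {u u′ : Fin (2 * l ∸ 1)}
         (u′≡ : toℕ u′ ≡ suc (toℕ u)) (u+1<l : suc (toℕ u) < l) where
  private
    G = A l
    M = 2 * l ∸ 1
    c = toℕ u
    τ = transpose u u′
    σ = transpose u′ u

    σ-injective : Injective _≡_ _≡_ σ
    σ-injective {a} {b} eq = trans (sym (transpose-inverse u u′)) (trans (cong τ eq) (transpose-inverse u u′))

    τ-injective : Injective _≡_ _≡_ τ
    τ-injective {a} {b} eq = trans (sym (transpose-inverse u′ u)) (trans (cong σ eq) (transpose-inverse u′ u))

    -- Moving u to u + 1 keeps it within distance l - 1 of every vertex other than u + 1, as u + 1 ≤ l - 1.
    σ-near : ∀ {a b} → a ≢ u′ → b ≢ u′ → a ≢ b → Near (l ∸ 1) (toℕ a) (toℕ b) →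
      Near (l ∸ 1) (toℕ (σ a)) (toℕ (σ b))
    σ-near {a} {b} a≢u′ b≢u′ a≢b near with a Fin.≟ u | b Fin.≟ u
    ... | yes refl | yes refl = ⊥-elim (a≢b refl)
    ... | yes refl | no b≢u rewrite transpose-j u′ u | transpose-other b≢u′ b≢u | u′≡ =
      Near-suc (<⇒≤∸1 u+1<l) near
    ... | no a≢u | yes refl rewrite transpose-j u′ u | transpose-other a≢u′ a≢u | u′≡ =
      Near-sym (Near-suc (<⇒≤∸1 u+1<l) (Near-sym near))
    ... | no a≢u | no b≢u rewrite transpose-other a≢u′ a≢u | transpose-other b≢u′ b≢u = near

    σ-preserves-adj : ∀ {a b} → a ≢ u′ → b ≢ u′ → adj G a b ≡ true → adj G (σ a) (σ b) ≡ true
    σ-preserves-adj {a} {b} a≢u′ b≢u′ aab = adjA⁺ l (σ a) (σ b) (adj⇒≢ G {a} {b} aab ∘ σ-injective)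
      (σ-near a≢u′ b≢u′ (adj⇒≢ G {a} {b} aab) (adjA⁻ l a b aab))

  swap-isCopy : ∀ p → IsFCopyAt F G u p → ¬ HasVertex u′ p → IsFCopyAt F G u′ (pull τ p)
  swap-isCopy p p-copy u′∉p =
    pull-isCopy F G G τ-injective P σ∘f-isEmbedding (λ i → transpose-inverse u u′) (transpose-j u u′)
    where
    P = isCopy⇒presentation F G p p-copy
    open Presentation P renaming (emb to f)
    f≢u′ : ∀ i → f i ≢ u′
    f≢u′ i fi≡u′ = u′∉p (subst (HasVertex u′) (sym p≡image) (image-hasVertex⁺ F f (i , fi≡u′)))
    σ∘f-isEmbedding : IsEmbedding F G (σ ∘ f)
    σ∘f-isEmbedding = record
      { injective     = IsEmbedding.injective isEmbedding ∘ σ-injective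
      ; preserves-adj = σ-preserves-adj (f≢u′ _) (f≢u′ _) ∘ IsEmbedding.preserves-adj isEmbedding }

  u∉swap : ∀ p → ¬ HasVertex u′ p → ¬ HasVertex u (pull τ p)
  u∉swap p u′∉p u∈ =
    u′∉p (trans (cong (hasVertex p) (sym (transpose-i u u′))) (trans (sym (hasVertex-pull τ p u)) u∈))

  swap-injective : ∀ p q → IsFCopyAt F G u p → IsFCopyAt F G u q → pull τ p ≡ pull τ q → p ≡ q
  swap-injective p q p-copy q-copy = pull-injective F G G τ-injective P Q
    {σ ∘ Presentation.emb P} {σ ∘ Presentation.emb Q} (λ i → transpose-inverse u u′) (λ i → transpose-inverse u u′)
    where
    P = isCopy⇒presentation F G p p-copy
    Q = isCopy⇒presentation F G q q-copy

  module _ {x y : Fin (size F)} (xy : adj F x y ≡ true) where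
    private
      n = size F

      2≤n : 2 ≤ n
      2≤n = subst (2 ≤_) (length-edgeFirst F G xy) (s≤s (s≤s z≤n))

      2≤l : 2 ≤ l
      2≤l = ≤-trans (s≤s (s≤s z≤n)) u+1<l

      c+l<M : c + l < M
      c+l<M = c+l<2l∸1 u+1<l

      far : Fin M
      far = fromℕ< c+l<M

      toℕ-far : toℕ far ≡ c + l
      toℕ-far = Fin.toℕ-fromℕ< c+l<M

      between-bound : 2 + c + (l ∸ 2) ≤ M
      between-bound = ≤-trans (≤-reflexive (2+c+[l∸2]≡c+l 2≤l)) (<⇒≤ c+l<M)

      between : List (Fin M)
      between = range (2 + c) (l ∸ 2) between-bound

      ∈-between⁻ : ∀ {w} → w ∈ between → 2 + c ≤ toℕ w × toℕ w < c + l
      ∈-between⁻ {w} w∈ = let (lo , hi) = ∈-range⁻ (2 + c) (l ∸ 2) between-bound w∈ in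
        lo , subst (toℕ w <_) (2+c+[l∸2]≡c+l 2≤l) hi

      cliqueCopy : List (Fin M) → Pair M
      cliqueCopy X = image F (cliqueEmbedding F G xy u′ far X)

      2+c≤c+l : 2 + c ≤ c + l
      2+c≤c+l = subst (_≤ c + l) (+-comm c 2) (+-monoʳ-≤ c 2≤l)

      c+l≡ : c + l ≡ suc c + (l ∸ 1)
      c+l≡ = trans (cong (c +_) (sym (m+[n∸m]≡n (≤-trans (s≤s z≤n) 2≤l)))) (+-suc c (l ∸ 1))

      c<c+l : suc c ≤ c + l
      c<c+l = ≤-trans (n≤1+n _) 2+c≤c+l

      u′∉between : u′ ∉ between
      u′∉between w∈ = 1+n≰n (subst (2 + c ≤_) u′≡ (proj₁ (∈-between⁻ w∈)))

      far∉between : far ∉ between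
      far∉between w∈ = <-irrefl toℕ-far (proj₂ (∈-between⁻ w∈))

      between-unique : Unique between
      between-unique = range-unique (2 + c) (l ∸ 2) between-bound

      module Clique {X} (X∈ : X ∈ subsets (n ∸ 2) between) where
        private
          X⊆between : ∀ {w} → w ∈ X → w ∈ between
          X⊆between = ∈-subsets⇒⊆ (n ∸ 2) between X∈

          bounds : ∀ {w} → w ∈ u′ ∷ far ∷ X → suc c ≤ toℕ w × toℕ w ≤ c + l
          bounds (here refl)         = ≤-reflexive (sym u′≡) , subst (_≤ c + l) (sym u′≡) c<c+l
          bounds (there (here refl)) = subst (suc c ≤_) (sym toℕ-far) c<c+l , ≤-reflexive toℕ-far
          bounds (there (there w∈))  =
            let (lo , hi) = ∈-between⁻ (X⊆between w∈) in ≤-trans (n≤1+n _) lo , <⇒≤ hi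

          W-unique : Unique (u′ ∷ far ∷ X)
          W-unique = Unique-∷ u′∉ (Unique-∷ (far∉between ∘ X⊆between)
                                   (∈-subsets⇒Unique (n ∸ 2) between-unique X∈))
            where
            u′∉ : u′ ∉ far ∷ X
            u′∉ (here u′≡far) = <-irrefl (trans (sym u′≡) (trans (cong toℕ u′≡far) toℕ-far)) 2+c≤c+l
            u′∉ (there w∈)    = u′∉between (X⊆between w∈)

          W-length : 2 + length X ≡ n
          W-length = trans (cong (2 +_) (∈-subsets⇒length (n ∸ 2) between X∈)) (m+[n∸m]≡n 2≤n)

          W-clique : ∀ {a b} → a ∈ u′ ∷ far ∷ X → b ∈ u′ ∷ far ∷ X → a ≢ b → adj G a b ≡ true
          W-clique {a} {b} a∈ b∈ a≢b =
            adjA⁺ l a b a≢b (close (bounds a∈) (bounds b∈) , close (bounds b∈) (bounds a∈))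
            where
            close : ∀ {i j} → suc c ≤ i × i ≤ c + l → suc c ≤ j × j ≤ c + l → i ≤ j + (l ∸ 1)
            close (_ , i≤) (j≥ , _) = ≤-trans i≤ (≤-trans (≤-reflexive c+l≡) (+-monoˡ-≤ (l ∸ 1) j≥))

          f = cliqueEmbedding F G xy u′ far X

        open CliqueEmbedding F G xy W-unique W-length W-clique

        isCopy : IsFCopyAt F G u′ (cliqueCopy X)
        isCopy = image-isCopy F G (cliqueEmbedding-isEmbedding)
                   (x , cliqueEmbedding-x)

        u∉ : ¬ HasVertex u (cliqueCopy X)
        u∉ u∈ = let (k , fk≡u) = image-hasVertex⁻ F f u∈ in
          1+n≰n (proj₁ (bounds (subst (_∈ u′ ∷ far ∷ X) fk≡u (cliqueEmbedding-∈ k))))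

        u′far-edge : hasEdge (cliqueCopy X) u′ far ≡ true
        u′far-edge = image-hasEdge⁺ F f (x , y , cliqueEmbedding-x
                                             , cliqueEmbedding-y , xy)

        ⊇X : ∀ {w} → w ∈ X → HasVertex w (cliqueCopy X)
        ⊇X w∈ = image-hasVertex⁺ F f (cliqueEmbedding-onto (there (there w∈)))

        ⊆W : ∀ {w} → HasVertex w (cliqueCopy X) → w ∈ u′ ∷ far ∷ X
        ⊆W w∈ = let (k , fk≡w) = image-hasVertex⁻ F f w∈ in
          subst (_∈ u′ ∷ far ∷ X) fk≡w (cliqueEmbedding-∈ k)

      cliqueCopy-injective : ∀ {X Y} → X ∈ subsets (n ∸ 2) between → Y ∈ subsets (n ∸ 2) between →
        cliqueCopy X ≡ cliqueCopy Y → X ≡ Y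
      cliqueCopy-injective {X} {Y} X∈ Y∈ eq = subsets-⊆⇒≡ (n ∸ 2) between-unique X∈ Y∈ X⊆Y
        where
        X⊆Y : ∀ {w} → w ∈ X → w ∈ Y
        X⊆Y {w} w∈X = ∈-∷-≢ (λ { refl → far∉between w∈between }) (∈-∷-≢ (λ { refl → u′∉between w∈between })
          (Clique.⊆W Y∈ (subst (HasVertex w) eq (Clique.⊇X X∈ w∈X))))
          where
          w∈between = ∈-subsets⇒⊆ (n ∸ 2) between X∈ w∈X

      -- Clique copies contain the edge u′ far; a swapped copy cannot, as it would come from the non-edge u far.
      swapped-no-edge : ∀ p → IsFCopyAt F G u p → ¬ hasEdge (pull τ p) u′ far ≡ true
      swapped-no-edge p p-copy e = 1+n≰n (begin
        suc (c + (l ∸ 1))  ≡⟨ c+l≡ ⟨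
        c + l              ≡⟨ toℕ-far ⟨
        toℕ far            ≤⟨ proj₂ (adjA⁻ l u far (isCopy-edge⇒adj F G p p-copy edge)) ⟩
        c + (l ∸ 1)        ∎)
        where
        open ≤-Reasoning
        far≢u : far ≢ u
        far≢u far≡u = <-irrefl (trans (sym (cong toℕ far≡u)) toℕ-far) c<c+l
        far≢u′ : far ≢ u′
        far≢u′ far≡u′ = <-irrefl (trans (sym u′≡) (trans (sym (cong toℕ far≡u′)) toℕ-far)) 2+c≤c+l
        edge : hasEdge p u far ≡ true
        edge = trans (sym (cong₂ (hasEdge p) (transpose-j u u′) (transpose-other far≢u far≢u′)))
                     (trans (sym (hasEdge-pull τ p u′ far)) e)

    avoiding-count : length (copiesWithout F G u u′) + (l ∸ 2) C (n ∸ 2) ≤ length (copiesWithout F G u′ u)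
    avoiding-count = begin
      length (copiesWithout F G u u′) + (l ∸ 2) C (n ∸ 2)
        ≡⟨ cong₂ _+_ (List.length-map (pull τ) (copiesWithout F G u u′)) family-length ⟨
      length swapped + length family
        ≡⟨ List.length-++ swapped ⟨
      length (swapped ++ family)
        ≤⟨ length-≤-of-⊆ unique ⊆copiesWithout ⟩
      length (copiesWithout F G u′ u) ∎
      where
      open ≤-Reasoning
      swapped = map (pull τ) (copiesWithout F G u u′)
      family = map cliqueCopy (subsets (n ∸ 2) between)

      family-length : length family ≡ (l ∸ 2) C (n ∸ 2)
      family-length = trans (List.length-map cliqueCopy (subsets (n ∸ 2) between))
        (trans (length-subsets (n ∸ 2) between)
          (cong (_C (n ∸ 2)) (length-range (2 + c) (l ∸ 2) between-bound)))

      disjoint : ∀ {q} → ¬ (q ∈ swapped × q ∈ family)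
      disjoint (q∈₁ , q∈₂) with ∈-map⁻ (pull τ) q∈₁ | ∈-map⁻ cliqueCopy q∈₂
      ... | p , p∈ , refl | X , X∈ , eq = swapped-no-edge p (proj₁ (∈-copiesWithout⁻ F G p∈))
        (subst (λ q → hasEdge q u′ far ≡ true) (sym eq) (Clique.u′far-edge X∈))

      unique : Unique (swapped ++ family)
      unique = Unique.++⁺
        (Unique-map-on (pull τ) (copiesWithout-unique F G u u′) λ {p} {q} p∈ q∈ →
          swap-injective p q (proj₁ (∈-copiesWithout⁻ F G p∈)) (proj₁ (∈-copiesWithout⁻ F G q∈)))
        (Unique-map-on cliqueCopy (subsets-unique (n ∸ 2) between-unique) cliqueCopy-injective)
        disjoint

      ⊆copiesWithout : ∀ {q} → q ∈ swapped ++ family → q ∈ copiesWithout F G u′ u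
      ⊆copiesWithout q∈ with ∈-++⁻ swapped q∈
      ... | inj₁ q∈₁ = let (p , p∈ , q≡) = ∈-map⁻ (pull τ) q∈₁
                           (p-copy , u′∉p) = ∈-copiesWithout⁻ F G p∈ in
        subst (_∈ copiesWithout F G u′ u) (sym q≡)
          (∈-copiesWithout⁺ F G (pull τ p) (swap-isCopy p p-copy u′∉p) (u∉swap p u′∉p))
      ... | inj₂ q∈₂ = let (X , X∈ , q≡) = ∈-map⁻ cliqueCopy q∈₂ in
        subst (_∈ copiesWithout F G u′ u) (sym q≡)
          (∈-copiesWithout⁺ F G (cliqueCopy X) (Clique.isCopy X∈) (Clique.u∉ X∈))

    swap-count : FDegree F G u + (l ∸ 2) C (n ∸ 2) ≤ FDegree F G u′
    swap-count = begin
      FDegree F G u + C′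
        ≡⟨ cong (_+ C′) (FDegree-split F G u u′) ⟩
      length (copiesWith F G u u′) + length (copiesWithout F G u u′) + C′
        ≡⟨ +-assoc (length (copiesWith F G u u′)) _ C′ ⟩
      length (copiesWith F G u u′) + (length (copiesWithout F G u u′) + C′)
        ≤⟨ +-mono-≤ (≤-reflexive (length-copiesWith-comm F G u u′)) avoiding-count ⟩
      length (copiesWith F G u′ u) + length (copiesWithout F G u′ u)
        ≡⟨ FDegree-split F G u′ u ⟨
      FDegree F G u′ ∎
      where
      open ≤-Reasoning
      C′ = (l ∸ 2) C (n ∸ 2)


-- f_l - z_l as the number of copies through l and 2l

module _ (F : Graph) (l′ t : ℕ) where
  private
    l = suc l′
    M = 2 * l ∸ 1
    G = A l
    H = Fgraph l t
    N = last l′ t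

  restrict : Pair (suc M) → Pair M
  restrict = pull inject₁

  module _ (v : Fin M) where

    module _ (q : Pair (suc M)) (q-copy : IsFCopyAt F H (inject₁ v) q) (N∉q : ¬ HasVertex N q) where
      private
        Q = isCopy⇒presentation F H q q-copy
        open Presentation Q renaming (emb to f)

        M≢f : ∀ i → M ≢ toℕ (f i)
        M≢f i M≡fi = N∉q (subst (HasVertex N) (sym p≡image) (image-hasVertex⁺ F f
          (i , Fin.toℕ-injective (trans (sym M≡fi) (sym (Fin.toℕ-fromℕ M))))))

      lowered : Fin (size F) → Fin M
      lowered i = lower₁ (f i) (M≢f i)

      inject₁-lowered : ∀ i → inject₁ (lowered i) ≡ f i
      inject₁-lowered i = Fin.inject₁-lower₁ (f i) (M≢f i)

      restrict-isCopy : IsFCopyAt F G v (restrict q)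
      restrict-isCopy = pull-isCopy F H G Fin.inject₁-injective Q lowered-isEmbedding inject₁-lowered refl
        where
        lowered-isEmbedding : IsEmbedding F G lowered
        lowered-isEmbedding = record
          { injective     = λ {i} {j} eq → IsEmbedding.injective isEmbedding
              (trans (sym (inject₁-lowered i)) (trans (cong inject₁ eq) (inject₁-lowered j)))
          ; preserves-adj = λ {i} {j} aij → trans (sym (adjF-inject₁ l′ t (lowered i) (lowered j)))
              (subst₂ (λ a b → adj H a b ≡ true) (sym (inject₁-lowered i)) (sym (inject₁-lowered j))
                (IsEmbedding.preserves-adj isEmbedding aij)) }

    restrict-injective : ∀ q q′ (q-copy : IsFCopyAt F H (inject₁ v) q) (N∉q : ¬ HasVertex N q)
      (q′-copy : IsFCopyAt F H (inject₁ v) q′) (N∉q′ : ¬ HasVertex N q′) → restrict q ≡ restrict q′ → q ≡ q′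
    restrict-injective q q′ q-copy N∉q q′-copy N∉q′ = pull-injective F H G Fin.inject₁-injective
      (isCopy⇒presentation F H q q-copy) (isCopy⇒presentation F H q′ q′-copy)
      (inject₁-lowered q q-copy N∉q) (inject₁-lowered q′ q′-copy N∉q′)

    module _ (p : Pair M) (p-copy : IsFCopyAt F G v p) where
      open Presentation (isCopy⇒presentation F G p p-copy) renaming (emb to f)

      extend : Pair (suc M)
      extend = image F (inject₁ ∘ f)

      extend-isCopy : IsFCopyAt F H (inject₁ v) extend
      extend-isCopy = image-isCopy F H record
        { injective     = IsEmbedding.injective isEmbedding ∘ Fin.inject₁-injective
        ; preserves-adj = λ {i} {j} aij →
            trans (adjF-inject₁ l′ t (f i) (f j)) (IsEmbedding.preserves-adj isEmbedding aij) }
        (let (i , fi≡v) = hits-v in i , cong inject₁ fi≡v)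

      N∉extend : ¬ HasVertex N extend
      N∉extend N∈ = let (i , fi≡N) = image-hasVertex⁻ F (inject₁ ∘ f) N∈ in Fin.fromℕ≢inject₁ (sym fi≡N)

      restrict-extend : restrict extend ≡ p
      restrict-extend = trans (pull-image F Fin.inject₁-injective (λ i → refl)) (sym p≡image)

    length-copiesWithout-last : length (copiesWithout F H (inject₁ v) N) ≡ FDegree F G v
    length-copiesWithout-last = ≤-antisym
      (length-≤-by-injection restrict (copiesWithout-unique F H (inject₁ v) N)
        (λ {q} {q′} q∈ q′∈ → let (q-copy , N∉q) = ∈-copiesWithout⁻ F H q∈
                                 (q′-copy , N∉q′) = ∈-copiesWithout⁻ F H q′∈ in
           restrict-injective q q′ q-copy N∉q q′-copy N∉q′)
        (λ {q} q∈ → let (q-copy , N∉q) = ∈-copiesWithout⁻ F H q∈ in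
           ∈-filter⁺ (isFCopyAt? F G v) (∈-allPairs F G (restrict q)) (restrict-isCopy q q-copy N∉q)))
      (length-≤-by-surjection restrict (Unique.filter⁺ _ (allPairs-unique F G))
        (λ {p} p∈ → let p-copy = proj₂ (∈-filter⁻ (isFCopyAt? F G v) {xs = allPairs F G} p∈) in
           extend p p-copy , ∈-copiesWithout⁺ F H _ (extend-isCopy p p-copy) (N∉extend p p-copy) ,
           restrict-extend p p-copy))

    FDegree-extension : FDegree F H (inject₁ v) ≡ length (copiesWith F H (inject₁ v) N) + FDegree F G v
    FDegree-extension = trans (FDegree-split F H (inject₁ v) N)
      (cong (length (copiesWith F H (inject₁ v) N) +_) length-copiesWithout-last)


-- A copy of F through l and 2l: a vertex x of minimum degree goes to 2l, its t neighbours to 1, ..., t,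
-- and its r = n - t - 1 non-neighbours to l - r + 1, ..., l, inside the clique 1, ..., l.
module _ (F : Graph) (t : ℕ) (diam : HasDiameter2 F) (mindeg : IsMinDegree F t)
         (l′ : ℕ) (n<l : size F < suc l′) where
  private
    n = size F
    l = suc l′
    M = 2 * l ∸ 1
    H = Fgraph l t
    N = last l′ t

    x : Fin n
    x = proj₁ (proj₁ mindeg)

    non-neighbour? : (k : Fin n) → Dec (¬ adj F x k ≡ true × k ≢ x)
    non-neighbour? k = ¬? (adj F x k ≟ᵇ true) ×-dec ¬? (k Fin.≟ x)

    others : List (Fin n)
    others = filter non-neighbour? (allFin n)

    r = length others

    order : List (Fin n)
    order = x ∷ (neighbours F x ++ others)

    order-unique : Unique order
    order-unique = Unique-∷ x∉ (Unique.++⁺ (neighbours-unique F x)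
      (Unique.filter⁺ non-neighbour? (Unique.allFin⁺ n))
      λ (k∈₁ , k∈₂) → proj₁ (proj₂ (∈-filter⁻ non-neighbour? {xs = allFin n} k∈₂)) (∈-neighbours⁻ F k∈₁))
      where
      x∉ : x ∉ neighbours F x ++ others
      x∉ x∈ with ∈-++⁻ (neighbours F x) x∈
      ... | inj₁ x∈₁ = adj⇒≢ F (∈-neighbours⁻ F x∈₁) refl
      ... | inj₂ x∈₂ = proj₂ (proj₂ (∈-filter⁻ non-neighbour? {xs = allFin n} x∈₂)) refl

    ∈-order : ∀ k → k ∈ order
    ∈-order k with k Fin.≟ x | adj F x k ≟ᵇ true
    ... | yes refl | _        = here refl
    ... | no _     | yes xk   = there (∈-++⁺ˡ (∈-neighbours⁺ F xk))
    ... | no k≢x   | no ¬xk   =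
      there (∈-++⁺ʳ (neighbours F x) (∈-filter⁺ non-neighbour? (∈-allFin k) (¬xk , k≢x)))

    1+t+r≡n : suc (t + r) ≡ n
    1+t+r≡n = trans (cong (λ d → suc (d + r)) (sym (proj₂ (proj₁ mindeg))))
      (trans (cong suc (sym (List.length-++ (neighbours F x)))) (length-of-complete order-unique ∈-order))

    1≤r : 1 ≤ r
    1≤r = +-cancelˡ-≤ (suc t) 1 r (begin
      suc t + 1    ≡⟨ +-suc t 1 ⟨
      t + 2        ≤⟨ minDegree+2≤size F diam t mindeg ⟩
      n            ≡⟨ 1+t+r≡n ⟨
      suc (t + r)  ∎)
      where open ≤-Reasoning

    t+r<l : t + r < l
    t+r<l = ≤-trans (≤-reflexive 1+t+r≡n) (<⇒≤ n<l)

    r≤l : r ≤ l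
    r≤l = ≤-trans (m≤n+m r t) (<⇒≤ t+r<l)

    l≤M : l ≤ M
    l≤M = ≤-trans (≤-reflexive (cong suc (sym (+-identityʳ l′)))) (m≤n+m (suc (l′ + 0)) l′)

    low-bound : 0 + t ≤ suc M
    low-bound = ≤-trans (≤-trans (m≤m+n t r) (<⇒≤ t+r<l)) (≤-trans l≤M (n≤1+n M))

    high-bound : (l ∸ r) + r ≤ suc M
    high-bound = ≤-trans (≤-reflexive (m∸n+n≡m r≤l)) (≤-trans l≤M (n≤1+n M))

    low = range 0 t low-bound
    high = range (l ∸ r) r high-bound

    targets : List (Fin (suc M))
    targets = N ∷ (low ++ high)

    below-l : ∀ {a} → a ∈ low ++ high → toℕ a < l
    below-l a∈ with ∈-++⁻ low a∈
    ... | inj₁ a∈low  = ≤-trans (proj₂ (∈-range⁻ 0 t low-bound a∈low)) (≤-trans (m≤m+n t r) (<⇒≤ t+r<l))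
    ... | inj₂ a∈high = ≤-trans (proj₂ (∈-range⁻ (l ∸ r) r high-bound a∈high)) (≤-reflexive (m∸n+n≡m r≤l))

    targets-unique : Unique targets
    targets-unique = Unique-∷ (λ N∈ → <-irrefl (Fin.toℕ-fromℕ M) (≤-trans (below-l N∈) l≤M))
      (Unique.++⁺ (range-unique 0 t low-bound) (range-unique (l ∸ r) r high-bound)
        λ (a∈low , a∈high) → <-irrefl refl (≤-trans (proj₂ (∈-range⁻ 0 t low-bound a∈low))
          (≤-trans (m+n≤o⇒m≤o∸n t (<⇒≤ t+r<l)) (proj₁ (∈-range⁻ (l ∸ r) r high-bound a∈high)))))

    length-order≡length-targets : length order ≡ length targets
    length-order≡length-targets = cong suc (begin
      length (neighbours F x ++ others)  ≡⟨ List.length-++ (neighbours F x) ⟩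
      length (neighbours F x) + r        ≡⟨ cong (_+ r) (proj₂ (proj₁ mindeg)) ⟩
      t + r                              ≡⟨ cong₂ _+_ (length-range 0 t low-bound) (length-range (l ∸ r) r high-bound) ⟨
      length low + length high           ≡⟨ List.length-++ low ⟨
      length (low ++ high)               ∎)
      where open ≡-Reasoning

    f : Fin n → Fin (suc M)
    f = lookupZip Fin._≟_ N order targets

    f-injective : ∀ {i j} → f i ≡ f j → i ≡ j
    f-injective = lookupZip-injective Fin._≟_ N order-unique targets-unique length-order≡length-targets
                    (∈-order _) (∈-order _)

    f-x : f x ≡ N
    f-x = lookupZip-head Fin._≟_ N x (neighbours F x ++ others) N (low ++ high)

    f-others : ∀ {k} → k ≢ x → f k ≡ lookupZip Fin._≟_ N (neighbours F x ++ others) (low ++ high) k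
    f-others = lookupZip-tail Fin._≟_ N {as = neighbours F x ++ others} {bs = low ++ high}

    f-below-l : ∀ {k} → k ≢ x → toℕ (f k) < l
    f-below-l {k} k≢x with ∈-order k
    ... | here k≡x = ⊥-elim (k≢x k≡x)
    ... | there k∈ = subst (λ a → toℕ a < l) (sym (f-others k≢x))
                       (below-l (lookupZip-∈ Fin._≟_ N (suc-injective length-order≡length-targets) k∈))

    f-neighbour : ∀ {k} → adj F x k ≡ true → toℕ (f k) < t
    f-neighbour {k} xk = subst (λ a → toℕ a < t)
      (sym (trans (f-others (adj⇒≢ F xk ∘ sym)) (lookupZip-++ˡ Fin._≟_ N others high nb≡low k∈)))
      (proj₂ (∈-range⁻ 0 t low-bound (lookupZip-∈ Fin._≟_ N nb≡low k∈)))
      where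
      k∈ = ∈-neighbours⁺ F xk
      nb≡low : length (neighbours F x) ≡ length low
      nb≡low = trans (proj₂ (proj₁ mindeg)) (sym (length-range 0 t low-bound))

    f-isEmbedding : IsEmbedding F H f
    f-isEmbedding = record { injective = f-injective ; preserves-adj = preserves-adj }
      where
      f≢N : ∀ {k} → k ≢ x → f k ≢ N
      f≢N k≢x fk≡N = k≢x (f-injective (trans fk≡N (sym f-x)))
      N-adj : ∀ {k} → adj F x k ≡ true → adj H N (f k) ≡ true
      N-adj xk = adjF-last⁺ l′ t (f-neighbour xk) (f≢N (adj⇒≢ F xk ∘ sym))
      preserves-adj : ∀ {i j} → adj F i j ≡ true → adj H (f i) (f j) ≡ true
      preserves-adj {i} {j} aij = cases (i Fin.≟ x) (j Fin.≟ x)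
        where
        near : ∀ {a b} → a < l → b < l → a ≤ b + (l ∸ 1)
        near {a} {b} a<l _ = ≤-trans (<⇒≤∸1 a<l) (m≤n+m (l ∸ 1) b)
        cases : Dec (i ≡ x) → Dec (j ≡ x) → adj H (f i) (f j) ≡ true
        cases (yes refl) (yes refl) = ⊥-elim (adj⇒≢ F aij refl)
        cases (yes refl) (no _)     = subst (λ a → adj H a (f j) ≡ true) (sym f-x) (N-adj aij)
        cases (no _)     (yes refl) = trans (Graph.sym H (f i) (f x))
          (subst (λ a → adj H a (f i) ≡ true) (sym f-x) (N-adj (trans (Graph.sym F x i) aij)))
        cases (no i≢x)   (no j≢x)   = adjF-below⁺ l′ t (f i) (f j) (≤-trans (f-below-l i≢x) l≤M)
          (≤-trans (f-below-l j≢x) l≤M) (adj⇒≢ F aij ∘ f-injective)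
          (near (f-below-l i≢x) (f-below-l j≢x) , near (f-below-l j≢x) (f-below-l i≢x))

  module _ (v : Fin M) (v≡ : toℕ v ≡ l ∸ 1) where

    copiesWith-last-nonempty : 1 ≤ length (copiesWith F H (inject₁ v) N)
    copiesWith-last-nonempty = ∈-length (∈-copiesWith⁺ F H (image F f)
      (image-isCopy F H f-isEmbedding hits-v) (image-hasVertex⁺ F f (x , f-x)))
      where
      v∈high : inject₁ v ∈ high
      v∈high = ∈-range⁺ (l ∸ r) r high-bound (inject₁ v)
        (subst (l ∸ r ≤_) (sym toℕ-v) (∸-monoʳ-≤ l 1≤r))
        (subst₂ _<_ (sym toℕ-v) (sym (m∸n+n≡m r≤l)) ≤-refl)
        where
        toℕ-v : toℕ (inject₁ v) ≡ l′
        toℕ-v = trans (Fin.toℕ-inject₁ v) v≡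
      hits-v : Hits F f (inject₁ v)
      hits-v = let (k , _ , fk≡v) = lookupZip-onto Fin._≟_ N order-unique length-order≡length-targets
                                      (there (∈-++⁺ʳ low v∈high)) in k , fk≡v


module _ (F : Graph) (t : ℕ) (diam : HasDiameter2 F) (mindeg : IsMinDegree F t)
         (l′ : ℕ) (n<l : size F < suc l′) (v : Fin (2 * suc l′ ∸ 1)) (v≡ : toℕ v ≡ suc l′ ∸ 1) where
  private
    n = size F
    l = suc l′
    M = 2 * l ∸ 1
    H = Fgraph l t
    N = last l′ t
    w = inject₁ v

    toℕ-w : toℕ w ≡ l′
    toℕ-w = trans (Fin.toℕ-inject₁ v) v≡

    toℕ-N : toℕ N ≡ M
    toℕ-N = Fin.toℕ-fromℕ M

    1≤t : 1 ≤ t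
    1≤t = 1≤minDegree F diam t mindeg

    t<l′ : t < l′
    t<l′ = ≤-trans (n≤1+n (suc t))
      (≤-pred (subst (_< l) (+-comm t 2) (≤-<-trans (minDegree+2≤size F diam t mindeg) n<l)))

    M≡l′+l : M ≡ l′ + l
    M≡l′+l = cong (l′ +_) (+-identityʳ l)

    t+l′≡l+[t∸1] : t + l′ ≡ l + (t ∸ 1)
    t+l′≡l+[t∸1] = trans (cong (_+ l′) (sym (m+[n∸m]≡n 1≤t))) (cong suc (+-comm (t ∸ 1) l′))

    l+[t∸1]≤M : l + (t ∸ 1) ≤ M
    l+[t∸1]≤M = begin
      l + (t ∸ 1)   ≡⟨ t+l′≡l+[t∸1] ⟨
      t + l′        ≤⟨ +-monoˡ-≤ l′ (≤-trans (<⇒≤ t<l′) (n≤1+n l′)) ⟩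
      l + l′        ≡⟨ +-comm l l′ ⟩
      l′ + l        ≡⟨ M≡l′+l ⟨
      M             ∎
      where open ≤-Reasoning

    l′≤1+M : l′ ≤ suc M
    l′≤1+M = ≤-trans (n≤1+n l′) (≤-trans (≤-trans (m≤m+n l (t ∸ 1)) l+[t∸1]≤M) (n≤1+n M))

    low-bound : 0 + t ≤ suc M
    low-bound = ≤-trans (<⇒≤ t<l′) l′≤1+M

    mid₁-bound : t + (l′ ∸ t) ≤ suc M
    mid₁-bound = ≤-trans (≤-reflexive (m+[n∸m]≡n (<⇒≤ t<l′))) l′≤1+M

    mid₂-bound : l + (t ∸ 1) ≤ suc M
    mid₂-bound = ≤-trans l+[t∸1]≤M (n≤1+n M)

    low = range 0 t low-bound
    mid₁ = range t (l′ ∸ t) mid₁-bound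
    mid₂ = range l (t ∸ 1) mid₂-bound

    -- The vertices other than 1, ..., t, l and 2l within distance two of 2l in F_{2l}.
    mid : List (Fin (suc M))
    mid = mid₁ ++ mid₂

    fixed : List (Fin (suc M))
    fixed = low ++ w ∷ N ∷ []

    length-mid : length mid ≡ l ∸ 2
    length-mid = begin
      length (mid₁ ++ mid₂)          ≡⟨ List.length-++ mid₁ ⟩
      length mid₁ + length mid₂      ≡⟨ cong₂ _+_ (length-range t (l′ ∸ t) mid₁-bound)
                                                   (length-range l (t ∸ 1) mid₂-bound) ⟩
      (l′ ∸ t) + (t ∸ 1)             ≡⟨ +-∸-assoc (l′ ∸ t) 1≤t ⟨
      (l′ ∸ t) + t ∸ 1               ≡⟨ cong (_∸ 1) (m∸n+n≡m (<⇒≤ t<l′)) ⟩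
      l′ ∸ 1                         ∎
      where open ≡-Reasoning

    length-fixed : length fixed ≡ t + 2
    length-fixed = trans (List.length-++ low) (cong (_+ 2) (length-range 0 t low-bound))

    l′<M : l′ < M
    l′<M = ≤-trans (m≤m+n l (t ∸ 1)) l+[t∸1]≤M

    ∈-low⁻ : ∀ {a} → a ∈ low → toℕ a < t
    ∈-low⁻ a∈ = proj₂ (∈-range⁻ 0 t low-bound a∈)

    ∈-mid⁻ : ∀ {a} → a ∈ mid → t ≤ toℕ a × toℕ a < M × toℕ a ≢ l′
    ∈-mid⁻ {a} a∈ with ∈-++⁻ mid₁ a∈
    ... | inj₁ a∈₁ = let (lo , hi) = ∈-range⁻ t (l′ ∸ t) mid₁-bound a∈₁
                         a<l′ = subst (toℕ a <_) (m+[n∸m]≡n (<⇒≤ t<l′)) hi in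
      lo , <-trans a<l′ l′<M , <⇒≢ a<l′
    ... | inj₂ a∈₂ = let (lo , hi) = ∈-range⁻ l (t ∸ 1) mid₂-bound a∈₂ in
      ≤-trans (≤-trans (<⇒≤ t<l′) (n≤1+n l′)) lo , <-≤-trans hi l+[t∸1]≤M , >⇒≢ lo

    mid-unique : Unique mid
    mid-unique = Unique.++⁺ (range-unique t (l′ ∸ t) mid₁-bound) (range-unique l (t ∸ 1) mid₂-bound)
      λ (a∈₁ , a∈₂) → <⇒≱ (<-≤-trans (proj₂ (∈-range⁻ t (l′ ∸ t) mid₁-bound a∈₁))
                        (≤-reflexive (m+[n∸m]≡n (<⇒≤ t<l′))))
                      (≤-trans (n≤1+n l′) (proj₁ (∈-range⁻ l (t ∸ 1) mid₂-bound a∈₂)))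

    fixed-or-mid : ∀ a → toℕ a < l + (t ∸ 1) → a ∈ fixed ⊎ a ∈ mid
    fixed-or-mid a a< with toℕ a <? t
    ... | yes a<t = inj₁ (∈-++⁺ˡ (∈-range⁺ 0 t low-bound a z≤n a<t))
    ... | no a≮t with toℕ a <? l′
    ...   | yes a<l′ = inj₂ (∈-++⁺ˡ (∈-range⁺ t (l′ ∸ t) mid₁-bound a (≮⇒≥ a≮t)
                         (subst (toℕ a <_) (sym (m+[n∸m]≡n (<⇒≤ t<l′))) a<l′)))
    ...   | no a≮l′ with toℕ a ≟ l′
    ...     | yes a≡l′ = inj₁ (∈-++⁺ʳ low (here (Fin.toℕ-injective (trans a≡l′ (sym toℕ-w)))))
    ...     | no a≢l′  = inj₂ (∈-++⁺ʳ mid₁ (∈-range⁺ l (t ∸ 1) mid₂-bound a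
                           (≤∧≢⇒< (≮⇒≥ a≮l′) (a≢l′ ∘ sym)) a<))

    fixed-unique : Unique fixed
    fixed-unique = Unique.++⁺ (range-unique 0 t low-bound)
      (Unique-∷ (λ { (here w≡N) → <-irrefl (trans (sym toℕ-w) (trans (cong toℕ w≡N) toℕ-N)) l′<M
                   ; (there ()) })
                (Unique-∷ (λ ()) []))
      λ { (a∈ , here refl) → <-irrefl toℕ-w (<-trans (∈-low⁻ a∈) t<l′)
        ; (a∈ , there (here refl)) → <-irrefl toℕ-N (<-trans (∈-low⁻ a∈) (<-trans t<l′ l′<M)) }

    fixed-mid-disjoint : ∀ {a} → a ∈ fixed → a ∉ mid
    fixed-mid-disjoint a∈ a∈mid with ∈-++⁻ low a∈ | ∈-mid⁻ a∈mid
    ... | inj₁ a∈low                   | t≤a , _ , _  = <⇒≱ (∈-low⁻ a∈low) t≤a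
    ... | inj₂ (here refl)             | _ , _ , a≢l′ = a≢l′ toℕ-w
    ... | inj₂ (there (here refl))     | _ , a<M , _  = <-irrefl toℕ-N a<M

    -- A copy through l and 2l is determined by the set X of its vertices in mid and by the position
    -- in fixed ++ X of the image of each vertex of F.
    Code = List (Fin (suc M)) × Vec (Fin n) n

    codes : List Code
    codes = cartesianProduct (subsets (n ∸ (t + 2)) mid) (injections n n)

    decode : Code → Pair (suc M)
    decode (X , π) = image F λ k → nth N (fixed ++ X) (toℕ (lookup π k))

    length-codes : length codes ≡ ((l ∸ 2) C (n ∸ (t + 2))) * n !
    length-codes = begin
      length codes
        ≡⟨ length-cartesianProductWith _,_ (subsets (n ∸ (t + 2)) mid) (injections n n) ⟩
      length (subsets (n ∸ (t + 2)) mid) * length (injections n n)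
        ≡⟨ cong₂ _*_ length-subsets-mid (length-injections n) ⟩
      ((l ∸ 2) C (n ∸ (t + 2))) * n ! ∎
      where
      open ≡-Reasoning
      length-subsets-mid : length (subsets (n ∸ (t + 2)) mid) ≡ (l ∸ 2) C (n ∸ (t + 2))
      length-subsets-mid = trans (length-subsets (n ∸ (t + 2)) mid) (cong (_C (n ∸ (t + 2))) length-mid)

    module _ (q : Pair (suc M)) (q-copy : IsFCopyAt F H w q) (N∈q : HasVertex N q) where
      open Presentation (isCopy⇒presentation F H q q-copy) renaming (emb to f)
      open IsEmbedding isEmbedding

      hit : ∀ {a} → HasVertex a q → Hits F f a
      hit a∈ = image-hasVertex⁻ F f (subst (HasVertex _) p≡image a∈)

      hit⁻ : ∀ {a} → Hits F f a → HasVertex a q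
      hit⁻ h = subst (HasVertex _) (sym p≡image) (image-hasVertex⁺ F f h)

      x : Fin n
      x = proj₁ (hit N∈q)

      f-x : f x ≡ N
      f-x = proj₂ (hit N∈q)

      f<M : ∀ {k} → k ≢ x → toℕ (f k) < M
      f<M {k} k≢x = ≤∧≢⇒< (≤-pred (Fin.toℕ<n (f k)))
        λ fk≡M → k≢x (injective (trans (Fin.toℕ-injective (trans fk≡M (sym toℕ-N))) (sym f-x)))

      f-neighbour : ∀ {k} → adj F x k ≡ true → toℕ (f k) < t
      f-neighbour xk = adjF-last⁻ l′ t (subst (λ a → adj H a (f _) ≡ true) f-x (preserves-adj xk))

      -- F has diameter two, so every vertex of the copy is within distance two of 2l.
      f-bound : ∀ {k} → k ≢ x → toℕ (f k) < l + (t ∸ 1)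
      f-bound {k} k≢x = by-adjacency (adj F x k) refl
        where
        by-adjacency : ∀ b → adj F x k ≡ b → toℕ (f k) < l + (t ∸ 1)
        by-adjacency true xk =
          <-≤-trans (f-neighbour xk) (≤-trans (≤-trans (<⇒≤ t<l′) (n≤1+n l′)) (m≤m+n l (t ∸ 1)))
        by-adjacency false xk = let (c , xc , ck) = proj₁ diam x k (k≢x ∘ sym) xk
                                    near = adjF-below⁻ l′ t (f c) (f k) (f<M (adj⇒≢ F xc ∘ sym)) (f<M k≢x)
                                             (preserves-adj ck) in
          subst (toℕ (f k) <_) t+l′≡l+[t∸1] (<-≤-trans (s≤s (proj₂ near)) (+-monoˡ-≤ l′ (f-neighbour xc)))

      -- x has at least t neighbours, all sent into the t vertices of low, so f is onto low.
      low-hit : ∀ {a} → a ∈ low → Hits F f a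
      low-hit {a} a∈ with hits? F f a
      ... | yes h = h
      ... | no ¬h = ⊥-elim (<⇒≱ (s≤s (proj₂ mindeg x)) (begin
        suc (degree F x)                    ≡⟨ cong suc (List.length-map f (neighbours F x)) ⟨
        length (a ∷ map f (neighbours F x)) ≤⟨ length-≤-of-⊆ unique ⊆low ⟩
        length low                          ≡⟨ length-range 0 t low-bound ⟩
        t                                   ∎))
        where
        open ≤-Reasoning
        unique : Unique (a ∷ map f (neighbours F x))
        unique = Unique-∷ (λ a∈′ → let (k , _ , a≡fk) = ∈-map⁻ f a∈′ in ¬h (k , sym a≡fk))
                          (Unique.map⁺ injective (neighbours-unique F x))
        ⊆low : ∀ {b} → b ∈ a ∷ map f (neighbours F x) → b ∈ low
        ⊆low (here refl) = a∈
        ⊆low (there b∈)  = let (k , k∈ , b≡fk) = ∈-map⁻ f b∈ in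
          subst (_∈ low) (sym b≡fk) (∈-range⁺ 0 t low-bound (f k) z≤n (f-neighbour (∈-neighbours⁻ F k∈)))

      Xq : List (Fin (suc M))
      Xq = filter (λ a → hasVertex? a q) mid

      Vq : List (Fin (suc M))
      Vq = fixed ++ Xq

      Vq-unique : Unique Vq
      Vq-unique = Unique.++⁺ fixed-unique (Unique.filter⁺ _ mid-unique)
        λ (a∈ , a∈Xq) → fixed-mid-disjoint a∈ (proj₁ (∈-filter⁻ (λ a → hasVertex? a q) a∈Xq))

      f∈Vq : ∀ k → f k ∈ Vq
      f∈Vq k = by-cases (k Fin.≟ x)
        where
        by-cases : Dec (k ≡ x) → f k ∈ Vq
        by-cases (yes refl) = ∈-++⁺ˡ (subst (_∈ fixed) (sym f-x) (∈-++⁺ʳ low (there (here refl))))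
        by-cases (no k≢x)   =
          [ ∈-++⁺ˡ , (λ fk∈mid → ∈-++⁺ʳ fixed (∈-filter⁺ (λ a → hasVertex? a q) fk∈mid (hit⁻ (k , refl)))) ]′
            (fixed-or-mid (f k) (f-bound k≢x))

      Vq-hit : ∀ {a} → a ∈ Vq → Hits F f a
      Vq-hit a∈ = [ [ low-hit , (λ { (here refl) → hits-v ; (there (here refl)) → x , f-x }) ]′ ∘ ∈-++⁻ low
                 , (λ a∈Xq → hit (proj₂ (∈-filter⁻ (λ a → hasVertex? a q) {xs = mid} a∈Xq))) ]′ (∈-++⁻ fixed a∈)

      length-Vq : length Vq ≡ n
      length-Vq = ≤-antisym
        (subst (length Vq ≤_) (trans (List.length-map f (allFin n)) (length-allFin n))
          (length-≤-of-⊆ Vq-unique λ a∈ → let (k , fk≡a) = Vq-hit a∈ in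
            subst (_∈ map f (allFin n)) fk≡a (∈-map⁺ f (∈-allFin k))))
        (subst (_≤ length Vq) (length-allFin n)
          (length-≤-by-injection f (Unique.allFin⁺ n) (λ _ _ → injective) (λ {k} _ → f∈Vq k)))

      Xq∈ : Xq ∈ subsets (n ∸ (t + 2)) mid
      Xq∈ = subst (λ k → Xq ∈ subsets k mid) length-Xq (filter∈subsets (λ a → hasVertex? a q) mid)
        where
        length-Xq : length Xq ≡ n ∸ (t + 2)
        length-Xq = sym (trans (cong (_∸ (t + 2)) (sym length-Vq))
          (trans (cong (_∸ (t + 2)) (trans (List.length-++ fixed) (cong (_+ length Xq) length-fixed)))
            (m+n∸m≡n (t + 2) (length Xq))))

      position : Fin n → Fin n
      position k = Fin.cast length-Vq (index (f∈Vq k))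

      positions : Vec (Fin n) n
      positions = tabulate position

      nth-positions : ∀ k → nth N Vq (toℕ (lookup positions k)) ≡ f k
      nth-positions k = begin
        nth N Vq (toℕ (lookup positions k))  ≡⟨ cong (nth N Vq ∘ toℕ) (Vec.lookup∘tabulate position k) ⟩
        nth N Vq (toℕ (position k))          ≡⟨ cong (nth N Vq) (Fin.toℕ-cast length-Vq (index (f∈Vq k))) ⟩
        nth N Vq (toℕ (index (f∈Vq k)))      ≡⟨ nth-lookup N Vq (index (f∈Vq k)) ⟩
        List.lookup Vq (index (f∈Vq k))      ≡⟨ Any.lookup-index (f∈Vq k) ⟨
        f k                                  ∎
        where open ≡-Reasoning

      positions-injective : ∀ {i j} → lookup positions i ≡ lookup positions j → i ≡ j
      positions-injective {i} {j} eq =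
        injective (trans (sym (nth-positions i)) (trans (cong (nth N Vq ∘ toℕ) eq) (nth-positions j)))

      decode-onto : ∃ λ c → c ∈ codes × decode c ≡ q
      decode-onto = (Xq , positions) , ∈-cartesianProduct⁺ Xq∈ (∈-injections positions positions-injective)
                  , trans (image-≗ F nth-positions) (sym p≡image)

  copiesWith-last-bound : length (copiesWith F H w N) ≤ ((l ∸ 2) C (n ∸ (t + 2))) * n !
  copiesWith-last-bound = subst (length (copiesWith F H w N) ≤_) length-codes
    (length-≤-by-surjection decode {xs = codes} (copiesWith-unique F H w N) λ {q} q∈ →
      let (q-copy , N∈q) = ∈-copiesWith⁻ F H q∈ in decode-onto q q-copy N∈q)

Cdiff-≥ : ∀ m {a b} → b ≤ a → Cdiff m a b ≡ m C (a ∸ b)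
Cdiff-≥ m {a} {b} b≤a with a <ᵇ b in a<ᵇb
... | true  = ⊥-elim (≤⇒≯ b≤a (<ᵇ⇒< a b (subst T (sym a<ᵇb) tt)))
... | false = refl

lemma10 : (F : Graph) (t l : ℕ) →
    HasDiameter2 F → IsMinDegree F t → size F < l →
    Cdiff (l ∸ 2) (size F) 2 > (size F) ! * Cdiff (l ∸ 2) (size F) (t + 2) →
    (v : Fin (2 * l ∸ 1)) (w : Fin (2 * l)) → toℕ v ≡ l ∸ 1 → toℕ w ≡ l ∸ 1 →
    (FDegree F (A l) v < FDegree F (Fgraph l t) w)
    × ((u u′ : Fin (2 * l ∸ 1)) → t ≤ toℕ u → suc (toℕ u) < l → toℕ u′ ≡ suc (toℕ u) →
       FDegree F (Fgraph l t) w ∸ FDegree F (A l) v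
         < FDegree F (A l) u′ ∸ FDegree F (A l) u)
lemma10 F t zero _ _ () _ _ _ _ _
lemma10 F t (suc l′) diam mindeg n<l hyp v w v≡ w≡
  with refl ← Fin.toℕ-injective {i = w} {j = inject₁ v} (trans w≡ (sym (trans (Fin.toℕ-inject₁ v) v≡))) =
  subst (z <_) (sym f≡D+z) (m<n+m z 1≤D) ,
  -- The gap bound holds for every u with u + 1 < l.
  λ u u′ _ u+1<l u′≡ → begin-strict
    FDegree F H w ∸ z        ≡⟨ cong (_∸ z) f≡D+z ⟩
    D + z ∸ z                ≡⟨ m+n∸n≡m D z ⟩
    D                        ≤⟨ copiesWith-last-bound F t diam mindeg l′ n<l v v≡ ⟩
    C₂ * n !                 <⟨ subst (_< C₁) (*-comm (n !) C₂) hyp′ ⟩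
    C₁                       ≤⟨ m+n≤o⇒m≤o∸n C₁ (subst (_≤ FDegree F (A l) u′) (+-comm _ C₁)
                                  (swap-count F l u′≡ u+1<l (proj₂ (has-neighbour F diam x₀)))) ⟩
    FDegree F (A l) u′ ∸ FDegree F (A l) u ∎
  where
  open ≤-Reasoning
  n = size F
  l = suc l′
  H = Fgraph l t
  z = FDegree F (A l) v
  D = length (copiesWith F H (inject₁ v) (last l′ t))
  C₁ = (l ∸ 2) C (n ∸ 2)
  C₂ = (l ∸ 2) C (n ∸ (t + 2))
  x₀ = proj₁ (proj₁ mindeg)
  f≡D+z = FDegree-extension F l′ t v
  1≤D = copiesWith-last-nonempty F t diam mindeg l′ n<l v v≡
  hyp′ : n ! * C₂ < C₁
  hyp′ = let t+2≤n = minDegree+2≤size F diam t mindeg in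
    subst₂ (λ a b → n ! * a < b) (Cdiff-≥ (l ∸ 2) t+2≤n) (Cdiff-≥ (l ∸ 2) (≤-trans (m≤n+m 2 t) t+2≤n))
      hyp
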